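{- Let $\mathbb{C}$ be a balanced monoidal category and $A$ a reflexive object of $\mathbb{C}$ with application $\mathsf{app}:A\otimes A\to A$ and currying $\mathsf{cur}$. Then $\mathbb{C}(I,A)$ is a balanced extensional $\mathbf{BC^{\pm}I}$-algebra with application $a\,b=(a\otimes b);\mathsf{app}$ and $\mathbf{B}=\mathsf{cur}(\mathsf{cur}(\mathsf{cur}((A\otimes\mathsf{app});\mathsf{app})))$, $\mathbf{I}=\mathsf{cur}(\mathrm{id}_A)$, $\mathbf{C}^\pm=\mathsf{cur}(\mathsf{cur}(\mathsf{cur}((A\otimes\sigma_{A,A}^{\pm1});(\mathsf{app}\otimes A);\mathsf{app})))$, $\boldsymbol{\theta}^\pm=\mathsf{cur}(\mathsf{cur}((A\otimes\theta_A^{\pm1});\mathsf{app}))$.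
   Context: A balanced monoidal category is a braided monoidal category (braid $\sigma_{X,Y}:X\otimes Y\to Y\otimes X$) with a natural isomorphism $\theta_X:X\to X$ such that $\theta_{X\otimes Y}=\sigma_{X,Y};(\theta_Y\otimes\theta_X);\sigma_{Y,X}$; it may be treated as strict, and $f;g$ denotes diagrammatic composition. A reflexive object is an object $A$ with a morphism $\mathsf{app}:A\otimes A\to A$ such that for every $f:X\otimes A\to A$ there is a unique $\mathsf{cur}(f):X\to A$ with $(\mathsf{cur}(f)\otimes A);\mathsf{app}=f$ (here $I\otimes A=A$ so $\mathsf{cur}$ of a morphism $A\to A$ is a morphism $I\to A$). Applicative structures have left-associative application; write $a\circ b:=\mathbf{B}\,a\,b$. An extensional $\mathbf{BC^{\pm}I}$-algebra is an applicative structure with elements $\mathbf{B},\mathbf{C}^+,\mathbf{C}^-,\mathbf{I}$ such that for all $a,b,c$ (each $\star$ ranging independently over $\{+,-\}$; $\pm/\mp$ linked and required for both choices): $\mathbf{B}\,a\,b\,c=a\,(b\,c)$; $\mathbf{C}^\star\,a\,b\,c=a\,c\,b$; $\mathbf{I}\,a=a$; $\mathbf{C}^+\,a\,b=\mathbf{C}^-\,a\,b$; $\mathbf{B}\,\mathbf{I}=\mathbf{I}$; $\mathbf{C}^\star\,\mathbf{B}\,\mathbf{I}=\mathbf{B}\,\mathbf{I}$; $(\mathbf{C}^\star\,\mathbf{B}\,\mathbf{B})\circ(\mathbf{B}\circ\mathbf{B})=(\mathbf{B}\,\mathbf{B})\circ\mathbf{B}$; $\mathbf{C}^\pm\circ\mathbf{C}^\mp=\mathbf{B}\,(\mathbf{B}\,\mathbf{I})$;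 $(\mathbf{C}^\star\,\mathbf{B}\,\mathbf{C}^\pm)\circ(\mathbf{B}\circ\mathbf{B})=(\mathbf{B}\,\mathbf{C}^\pm)\circ(\mathbf{B}\circ\mathbf{B})$; $(\mathbf{B}\,\mathbf{C}^\pm)\circ(\mathbf{C}^\pm\circ(\mathbf{B}\,\mathbf{C}^\pm))=\mathbf{C}^\pm\circ((\mathbf{B}\,\mathbf{C}^\pm)\circ\mathbf{C}^\pm)$; $(\mathbf{B}\,\mathbf{B})\circ\mathbf{C}^\pm=\mathbf{C}^\pm\circ((\mathbf{B}\,\mathbf{C}^\pm)\circ\mathbf{B})$. It is balanced with elements $\boldsymbol{\theta}^+,\boldsymbol{\theta}^-$ if for all $a$: $(\mathbf{B}\,\boldsymbol{\theta}^\pm)\circ\mathbf{B}=(\mathbf{C}^\star\,\mathbf{B}\,\boldsymbol{\theta}^\pm)\circ\mathbf{B}$; $\boldsymbol{\theta}^\pm\circ\boldsymbol{\theta}^\mp=\mathbf{B}\,\mathbf{I}$; $\mathbf{C}^\star\,\boldsymbol{\theta}^\star\,a=\mathbf{C}^\star\,\mathbf{I}\,a$; $\mathbf{B}\circ\boldsymbol{\theta}^\pm=\boldsymbol{\theta}^\pm\circ(\mathbf{C}^\pm\circ(\boldsymbol{\theta}^\pm\circ(\mathbf{C}^\pm\circ\mathbf{B})))$. -}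

module Defs where

open import Level using (Level; _⊔_) renaming (suc to lsuc)
open import Relation.Binary using (Rel; IsEquivalence; Setoid)

-- Signs ± used to index C^± , θ^± and σ^{±1}, θ_A^{±1}.
data Sign : Set where
  plus minus : Sign

opp : Sign → Sign
opp plus  = minus
opp minus = plus

-- Balanced monoidal categories (general, non-strict; hom-setoids;
-- composition written diagrammatically as f ⨾ g).

record BalancedMonoidalCategory (o ℓ e : Level) : Set (lsuc (o ⊔ ℓ ⊔ e)) where
  infix  4 _≈_ _⇒_
  infixr 9 _⨾_
  infixr 10 _⊗₀_ _⊗₁_
  field
    Obj : Set o
    _⇒_ : Obj → Obj → Set ℓ
    _≈_ : ∀ {X Y} → Rel (X ⇒ Y) e
    id  : ∀ {X} → X ⇒ X
    _⨾_ : ∀ {X Y Z} → X ⇒ Y → Y ⇒ Z → X ⇒ Z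

    ≈-equiv   : ∀ {X Y} → IsEquivalence (_≈_ {X} {Y})
    ⨾-resp-≈  : ∀ {X Y Z} {f f′ : X ⇒ Y} {g g′ : Y ⇒ Z} →
                f ≈ f′ → g ≈ g′ → (f ⨾ g) ≈ (f′ ⨾ g′)
    ⨾-assoc   : ∀ {W X Y Z} {f : W ⇒ X} {g : X ⇒ Y} {h : Y ⇒ Z} →
                ((f ⨾ g) ⨾ h) ≈ (f ⨾ (g ⨾ h))
    identityˡ : ∀ {X Y} {f : X ⇒ Y} → (id ⨾ f) ≈ f
    identityʳ : ∀ {X Y} {f : X ⇒ Y} → (f ⨾ id) ≈ f

    unit : Obj
    _⊗₀_ : Obj → Obj → Obj
    _⊗₁_ : ∀ {X Y Z W} → X ⇒ Y → Z ⇒ W → X ⊗₀ Z ⇒ Y ⊗₀ W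
    ⊗-resp-≈   : ∀ {X Y Z W} {f f′ : X ⇒ Y} {g g′ : Z ⇒ W} →
                 f ≈ f′ → g ≈ g′ → (f ⊗₁ g) ≈ (f′ ⊗₁ g′)
    ⊗-identity : ∀ {X Y} → (id {X} ⊗₁ id {Y}) ≈ id
    ⊗-homo     : ∀ {X Y Z X′ Y′ Z′} {f : X ⇒ Y} {g : Y ⇒ Z} {h : X′ ⇒ Y′} {k : Y′ ⇒ Z′} →
                 ((f ⨾ g) ⊗₁ (h ⨾ k)) ≈ ((f ⊗₁ h) ⨾ (g ⊗₁ k))

    α⇒ : ∀ {X Y Z} → (X ⊗₀ Y) ⊗₀ Z ⇒ X ⊗₀ (Y ⊗₀ Z)
    α⇐ : ∀ {X Y Z} → X ⊗₀ (Y ⊗₀ Z) ⇒ (X ⊗₀ Y) ⊗₀ Z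
    α-isoˡ : ∀ {X Y Z} → (α⇒ {X} {Y} {Z} ⨾ α⇐) ≈ id
    α-isoʳ : ∀ {X Y Z} → (α⇐ {X} {Y} {Z} ⨾ α⇒) ≈ id
    α-natural : ∀ {X Y Z X′ Y′ Z′} {f : X ⇒ X′} {g : Y ⇒ Y′} {h : Z ⇒ Z′} →
                (((f ⊗₁ g) ⊗₁ h) ⨾ α⇒) ≈ (α⇒ ⨾ (f ⊗₁ (g ⊗₁ h)))

    unitorˡ⇒ : ∀ {X} → unit ⊗₀ X ⇒ X
    unitorˡ⇐ : ∀ {X} → X ⇒ unit ⊗₀ X
    unitorˡ-isoˡ : ∀ {X} → (unitorˡ⇒ {X} ⨾ unitorˡ⇐) ≈ id
    unitorˡ-isoʳ : ∀ {X} → (unitorˡ⇐ {X} ⨾ unitorˡ⇒) ≈ id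
    unitorˡ-natural : ∀ {X Y} {f : X ⇒ Y} → ((id {unit} ⊗₁ f) ⨾ unitorˡ⇒) ≈ (unitorˡ⇒ ⨾ f)

    unitorʳ⇒ : ∀ {X} → X ⊗₀ unit ⇒ X
    unitorʳ⇐ : ∀ {X} → X ⇒ X ⊗₀ unit
    unitorʳ-isoˡ : ∀ {X} → (unitorʳ⇒ {X} ⨾ unitorʳ⇐) ≈ id
    unitorʳ-isoʳ : ∀ {X} → (unitorʳ⇐ {X} ⨾ unitorʳ⇒) ≈ id
    unitorʳ-natural : ∀ {X Y} {f : X ⇒ Y} → ((f ⊗₁ id {unit}) ⨾ unitorʳ⇒) ≈ (unitorʳ⇒ ⨾ f)

    triangle : ∀ {X Y} → (α⇒ {X} {unit} {Y} ⨾ (id ⊗₁ unitorˡ⇒)) ≈ (unitorʳ⇒ ⊗₁ id)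
    pentagon : ∀ {W X Y Z} →
               ((α⇒ {W} {X} {Y} ⊗₁ id {Z}) ⨾ (α⇒ ⨾ (id ⊗₁ α⇒)))
                 ≈ (α⇒ ⨾ α⇒)

    σ   : ∀ {X Y} → X ⊗₀ Y ⇒ Y ⊗₀ X
    σ⁻¹ : ∀ {X Y} → Y ⊗₀ X ⇒ X ⊗₀ Y
    σ-isoˡ : ∀ {X Y} → (σ {X} {Y} ⨾ σ⁻¹) ≈ id
    σ-isoʳ : ∀ {X Y} → (σ⁻¹ {X} {Y} ⨾ σ) ≈ id
    σ-natural : ∀ {X Y X′ Y′} {f : X ⇒ X′} {g : Y ⇒ Y′} →
                ((f ⊗₁ g) ⨾ σ) ≈ (σ ⨾ (g ⊗₁ f))
    hexagon₁ : ∀ {X Y Z} →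
               (α⇒ {X} {Y} {Z} ⨾ (σ ⨾ α⇒))
                 ≈ ((σ ⊗₁ id) ⨾ (α⇒ ⨾ (id ⊗₁ σ)))
    hexagon₂ : ∀ {X Y Z} →
               (α⇐ {X} {Y} {Z} ⨾ (σ ⨾ α⇐))
                 ≈ ((id ⊗₁ σ) ⨾ (α⇐ ⨾ (σ ⊗₁ id)))

    θ   : ∀ {X} → X ⇒ X
    θ⁻¹ : ∀ {X} → X ⇒ X
    θ-isoˡ : ∀ {X} → (θ {X} ⨾ θ⁻¹) ≈ id
    θ-isoʳ : ∀ {X} → (θ⁻¹ {X} ⨾ θ) ≈ id
    θ-natural : ∀ {X Y} {f : X ⇒ Y} → (f ⨾ θ) ≈ (θ ⨾ f)
    balance : ∀ {X Y} → θ {X ⊗₀ Y} ≈ (σ ⨾ ((θ ⊗₁ θ) ⨾ σ))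

  homSetoid : Obj → Obj → Setoid ℓ e
  homSetoid X Y = record { Carrier = X ⇒ Y ; _≈_ = _≈_ ; isEquivalence = ≈-equiv }

  σ± : ∀ {X} → Sign → X ⊗₀ X ⇒ X ⊗₀ X
  σ± plus  = σ
  σ± minus = σ⁻¹

  θ± : ∀ {X} → Sign → X ⇒ X
  θ± plus  = θ
  θ± minus = θ⁻¹

record ReflexiveObject {o ℓ e} (𝐂 : BalancedMonoidalCategory o ℓ e) : Set (o ⊔ ℓ ⊔ e) where
  open BalancedMonoidalCategory 𝐂
  field
    A   : Obj
    app : A ⊗₀ A ⇒ A
    cur : ∀ {X} → X ⊗₀ A ⇒ A → X ⇒ A
    cur-β      : ∀ {X} (f : X ⊗₀ A ⇒ A) → ((cur f ⊗₁ id) ⨾ app) ≈ f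
    cur-unique : ∀ {X} (f : X ⊗₀ A ⇒ A) (g : X ⇒ A) → ((g ⊗₁ id) ⨾ app) ≈ f → g ≈ cur f

record IsBalancedExtBCIAlgebra {c ℓ} (S : Setoid c ℓ)
         (_·_ : Setoid.Carrier S → Setoid.Carrier S → Setoid.Carrier S)
         (𝐁 𝐈 : Setoid.Carrier S) (𝐂 𝛉 : Sign → Setoid.Carrier S) : Set (c ⊔ ℓ) where
  open Setoid S
  infixl 9 _∙_
  _∙_ : Carrier → Carrier → Carrier
  a ∙ b = a · b
  _∘ᴮ_ : Carrier → Carrier → Carrier
  a ∘ᴮ b = 𝐁 ∙ a ∙ b
  field
    ·-cong : ∀ {a a′ b b′} → a ≈ a′ → b ≈ b′ → (a ∙ b) ≈ (a′ ∙ b′)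
    B-ax   : ∀ a b c → (𝐁 ∙ a ∙ b ∙ c) ≈ (a ∙ (b ∙ c))
    C-ax   : ∀ s a b c → (𝐂 s ∙ a ∙ b ∙ c) ≈ (a ∙ c ∙ b)
    I-ax   : ∀ a → (𝐈 ∙ a) ≈ a
    C⁺≈C⁻  : ∀ a b → (𝐂 plus ∙ a ∙ b) ≈ (𝐂 minus ∙ a ∙ b)
    ext₁   : (𝐁 ∙ 𝐈) ≈ 𝐈
    ext₂   : ∀ s → (𝐂 s ∙ 𝐁 ∙ 𝐈) ≈ (𝐁 ∙ 𝐈)
    ext₃   : ∀ s → ((𝐂 s ∙ 𝐁 ∙ 𝐁) ∘ᴮ (𝐁 ∘ᴮ 𝐁)) ≈ ((𝐁 ∙ 𝐁) ∘ᴮ 𝐁)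
    ext₄   : ∀ p → (𝐂 p ∘ᴮ 𝐂 (opp p)) ≈ (𝐁 ∙ (𝐁 ∙ 𝐈))
    ext₅   : ∀ s p → ((𝐂 s ∙ 𝐁 ∙ 𝐂 p) ∘ᴮ (𝐁 ∘ᴮ 𝐁)) ≈ ((𝐁 ∙ 𝐂 p) ∘ᴮ (𝐁 ∘ᴮ 𝐁))
    ext₆   : ∀ p → ((𝐁 ∙ 𝐂 p) ∘ᴮ (𝐂 p ∘ᴮ (𝐁 ∙ 𝐂 p)))
                     ≈ (𝐂 p ∘ᴮ ((𝐁 ∙ 𝐂 p) ∘ᴮ 𝐂 p))
    ext₇   : ∀ p → ((𝐁 ∙ 𝐁) ∘ᴮ 𝐂 p) ≈ (𝐂 p ∘ᴮ ((𝐁 ∙ 𝐂 p) ∘ᴮ 𝐁))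
    bal₁   : ∀ s p → ((𝐁 ∙ 𝛉 p) ∘ᴮ 𝐁) ≈ ((𝐂 s ∙ 𝐁 ∙ 𝛉 p) ∘ᴮ 𝐁)
    bal₂   : ∀ p → (𝛉 p ∘ᴮ 𝛉 (opp p)) ≈ (𝐁 ∙ 𝐈)
    bal₃   : ∀ s t a → (𝐂 s ∙ 𝛉 t ∙ a) ≈ (𝐂 s ∙ 𝐈 ∙ a)
    bal₄   : ∀ p → (𝐁 ∘ᴮ 𝛉 p) ≈ (𝛉 p ∘ᴮ (𝐂 p ∘ᴮ (𝛉 p ∘ᴮ (𝐂 p ∘ᴮ 𝐁))))

module Combinators {o ℓ e} (𝐂 : BalancedMonoidalCategory o ℓ e) (R : ReflexiveObject 𝐂) where
  open BalancedMonoidalCategory 𝐂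
  open ReflexiveObject R

  Elem : Set ℓ
  Elem = unit ⇒ A

  elemSetoid : Setoid ℓ e
  elemSetoid = homSetoid unit A

  -- cur of a morphism A → A, identifying I ⊗ A with A via the left unitor
  cur₀ : A ⇒ A → unit ⇒ A
  cur₀ f = cur (unitorˡ⇒ ⨾ f)

  -- a b = (a ⊗ b) ; app   (precomposed with I ≅ I ⊗ I)
  _·_ : Elem → Elem → Elem
  a · b = unitorˡ⇐ ⨾ ((a ⊗₁ b) ⨾ app)

  𝐁 : Elem
  𝐁 = cur₀ (cur (cur (α⇒ ⨾ ((id ⊗₁ app) ⨾ app))))

  𝐈 : Elem
  𝐈 = cur₀ id

  𝐂± : Sign → Elem
  𝐂± s = cur₀ (cur (cur (α⇒ ⨾ ((id ⊗₁ σ± s) ⨾ (α⇐ ⨾ ((app ⊗₁ id) ⨾ app))))))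

  𝛉± : Sign → Elem
  𝛉± s = cur₀ (cur ((id ⊗₁ θ± s) ⨾ app))

-- Two injective maps turn equations between global elements of A into equations between
-- morphisms: uncur f = (f ⊗ id) ⨾ app, injective by uniqueness of currying, and
-- act a = λ⁻¹ ⨾ uncur a : A ⇒ A, the action x ↦ a x, with a · b ≈ b ⨾ act a.
-- The definitions of the combinators give act (𝐁 · a · b) ≈ act b ⨾ act a and similar rules for
-- 𝐂± and 𝛉±, from which the β-laws follow at once.  For every other axiom, applying act and
-- uncurrying both sides one to three times removes all currying, and what is left is a
-- coherence identity of the balanced monoidal category: the pentagon (ext₃, ext₅),
-- σ ⨾ σ⁻¹ = id (ext₄), the hexagon (ext₇), the Yang–Baxter equation (ext₆),
-- θ ⨾ θ⁻¹ = id and θ_I = id (bal₂, bal₃), and the balance axiom (bal₄).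

{-# OPTIONS --safe #-}
module Submission where

open import Defs
open import Relation.Binary using (IsEquivalence)
import Relation.Binary.Reasoning.Setoid as SetoidReasoning

module HomReasoning {o ℓ e} (𝐂 : BalancedMonoidalCategory o ℓ e) where
  open BalancedMonoidalCategory 𝐂

  module ≈ {X Y : Obj} = IsEquivalence (≈-equiv {X} {Y})
  open ≈ public using (refl; sym; trans)

  module SetoidReasoningOnHoms {X Y : Obj} = SetoidReasoning (homSetoid X Y)
  open SetoidReasoningOnHoms public using (begin_; step-≈-⟩; step-≈-⟨; _∎)

  infixr 3 _○_
  _○_ : ∀ {X Y} {f g h : X ⇒ Y} → f ≈ g → g ≈ h → f ≈ h
  _○_ = trans

  infixr 5 _⟩⨾⟨_ refl⟩⨾⟨_
  infixl 5 _⟩⨾⟨refl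
  infixr 6 _⟩⊗⟨_

  _⟩⨾⟨_ : ∀ {X Y Z} {f f′ : X ⇒ Y} {g g′ : Y ⇒ Z} → f ≈ f′ → g ≈ g′ → (f ⨾ g) ≈ (f′ ⨾ g′)
  _⟩⨾⟨_ = ⨾-resp-≈

  refl⟩⨾⟨_ : ∀ {X Y Z} {f : X ⇒ Y} {g g′ : Y ⇒ Z} → g ≈ g′ → (f ⨾ g) ≈ (f ⨾ g′)
  refl⟩⨾⟨ p = ⨾-resp-≈ refl p

  _⟩⨾⟨refl : ∀ {X Y Z} {f f′ : X ⇒ Y} {g : Y ⇒ Z} → f ≈ f′ → (f ⨾ g) ≈ (f′ ⨾ g)
  p ⟩⨾⟨refl = ⨾-resp-≈ p refl

  _⟩⊗⟨_ : ∀ {X Y Z W} {f f′ : X ⇒ Y} {g g′ : Z ⇒ W} → f ≈ f′ → g ≈ g′ → (f ⊗₁ g) ≈ (f′ ⊗₁ g′)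
  _⟩⊗⟨_ = ⊗-resp-≈

  assoc : ∀ {W X Y Z} {f : W ⇒ X} {g : X ⇒ Y} {h : Y ⇒ Z} → ((f ⨾ g) ⨾ h) ≈ (f ⨾ g ⨾ h)
  assoc = ⨾-assoc

  sym-assoc : ∀ {W X Y Z} {f : W ⇒ X} {g : X ⇒ Y} {h : Y ⇒ Z} → (f ⨾ g ⨾ h) ≈ ((f ⨾ g) ⨾ h)
  sym-assoc = sym ⨾-assoc

  pullˡ : ∀ {W X Y Z} {g : W ⇒ X} {h : X ⇒ Y} {k : W ⇒ Y} {f : Y ⇒ Z} →
          (g ⨾ h) ≈ k → (g ⨾ h ⨾ f) ≈ (k ⨾ f)
  pullˡ p = sym-assoc ○ (p ⟩⨾⟨refl)

  cancelˡ : ∀ {X Y Z} {g : X ⇒ Y} {h : Y ⇒ X} {f : X ⇒ Z} → (g ⨾ h) ≈ id → (g ⨾ h ⨾ f) ≈ f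
  cancelˡ p = pullˡ p ○ identityˡ

  extendˡ : ∀ {W X X′ Y Z} {g : W ⇒ X} {h : X ⇒ Y} {g′ : W ⇒ X′} {h′ : X′ ⇒ Y} {f : Y ⇒ Z} →
            (g ⨾ h) ≈ (g′ ⨾ h′) → (g ⨾ h ⨾ f) ≈ (g′ ⨾ h′ ⨾ f)
  extendˡ p = pullˡ p ○ assoc

  cancel-splitEpi : ∀ {X Y Z} {p : X ⇒ Y} {p′ : Y ⇒ X} {f g : Y ⇒ Z} →
                    (p′ ⨾ p) ≈ id → (p ⨾ f) ≈ (p ⨾ g) → f ≈ g
  cancel-splitEpi i q = sym (cancelˡ i) ○ (refl⟩⨾⟨ q) ○ cancelˡ i

  cancel-splitMono : ∀ {X Y Z} {p : Y ⇒ Z} {p′ : Z ⇒ Y} {f g : X ⇒ Y} →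
                     (p ⨾ p′) ≈ id → (f ⨾ p) ≈ (g ⨾ p) → f ≈ g
  cancel-splitMono i q =
    sym identityʳ ○ (refl⟩⨾⟨ sym i) ○ pullˡ q ○ assoc ○ (refl⟩⨾⟨ i) ○ identityʳ

  inverse-unique : ∀ {X Y} {r l : X ⇒ Y} {u v : Y ⇒ X} →
                   (r ⨾ u) ≈ id → (v ⨾ l) ≈ id → u ≈ v → r ≈ l
  inverse-unique ru vl u≈v =
    sym identityʳ ○ (refl⟩⨾⟨ (sym vl ○ (sym u≈v ⟩⨾⟨refl))) ○ pullˡ ru ○ identityˡ

  ⨾₃-inverse : ∀ {W X Y Z} {a : W ⇒ X} {a′ : X ⇒ W} {b : X ⇒ Y} {b′ : Y ⇒ X}
                 {c : Y ⇒ Z} {c′ : Z ⇒ Y} →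
               (c ⨾ c′) ≈ id → (b ⨾ b′) ≈ id → (a ⨾ a′) ≈ id →
               ((a ⨾ b ⨾ c) ⨾ (c′ ⨾ b′ ⨾ a′)) ≈ id
  ⨾₃-inverse cc bb aa = assoc ○ (refl⟩⨾⟨ (assoc ○ (refl⟩⨾⟨ cancelˡ cc) ○ cancelˡ bb)) ○ aa

  ⊗-merge : ∀ {X Y Z X′ Y′ Z′} {f : X ⇒ Y} {g : Y ⇒ Z} {h : X′ ⇒ Y′} {k : Y′ ⇒ Z′} →
            ((f ⊗₁ h) ⨾ (g ⊗₁ k)) ≈ ((f ⨾ g) ⊗₁ (h ⨾ k))
  ⊗-merge = sym ⊗-homo

  serialize₁₂ : ∀ {X Y Z W} {f : X ⇒ Y} {g : Z ⇒ W} → (f ⊗₁ g) ≈ ((f ⊗₁ id) ⨾ (id ⊗₁ g))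
  serialize₁₂ = (sym identityʳ ⟩⊗⟨ sym identityˡ) ○ ⊗-homo

  serialize₂₁ : ∀ {X Y Z W} {f : X ⇒ Y} {g : Z ⇒ W} → (f ⊗₁ g) ≈ ((id ⊗₁ g) ⨾ (f ⊗₁ id))
  serialize₂₁ = (sym identityˡ ⟩⊗⟨ sym identityʳ) ○ ⊗-homo

  ⊗-slide : ∀ {X Y Z W} {f : X ⇒ Y} {g : Z ⇒ W} →
            ((f ⊗₁ id) ⨾ (id ⊗₁ g)) ≈ ((id ⊗₁ g) ⨾ (f ⊗₁ id))
  ⊗-slide = sym serialize₁₂ ○ serialize₂₁

  id⊗-homo : ∀ {X Y Z W} {f : Y ⇒ Z} {g : Z ⇒ W} → (id {X} ⊗₁ (f ⨾ g)) ≈ ((id ⊗₁ f) ⨾ (id ⊗₁ g))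
  id⊗-homo = (sym identityˡ ⟩⊗⟨ refl) ○ ⊗-homo

  ⊗id-homo : ∀ {X Y Z W} {f : Y ⇒ Z} {g : Z ⇒ W} → ((f ⨾ g) ⊗₁ id {X}) ≈ ((f ⊗₁ id) ⨾ (g ⊗₁ id))
  ⊗id-homo = (refl ⟩⊗⟨ sym identityˡ) ○ ⊗-homo

  ⊗-inverse : ∀ {X Y Z W} {f : X ⇒ Y} {f′ : Y ⇒ X} {g : Z ⇒ W} {g′ : W ⇒ Z} →
              (f ⨾ f′) ≈ id → (g ⨾ g′) ≈ id → ((f ⊗₁ g) ⨾ (f′ ⊗₁ g′)) ≈ id
  ⊗-inverse p q = ⊗-merge ○ (p ⟩⊗⟨ q) ○ ⊗-identity

  id⊗-inverse : ∀ {X Y Z} {f : Y ⇒ Z} {g : Z ⇒ Y} → (f ⨾ g) ≈ id → ((id {X} ⊗₁ f) ⨾ (id ⊗₁ g)) ≈ id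
  id⊗-inverse = ⊗-inverse identityˡ

  ⊗id-inverse : ∀ {X Y Z} {f : Y ⇒ Z} {g : Z ⇒ Y} → (f ⨾ g) ≈ id → ((f ⊗₁ id {X}) ⨾ (g ⊗₁ id)) ≈ id
  ⊗id-inverse p = ⊗-inverse p identityˡ

module MonoidalCoherence {o ℓ e} (𝐂 : BalancedMonoidalCategory o ℓ e) where
  open BalancedMonoidalCategory 𝐂
  open HomReasoning 𝐂

  α⇐-natural : ∀ {X Y Z X′ Y′ Z′} {f : X ⇒ X′} {g : Y ⇒ Y′} {h : Z ⇒ Z′} →
               ((f ⊗₁ (g ⊗₁ h)) ⨾ α⇐) ≈ (α⇐ ⨾ ((f ⊗₁ g) ⊗₁ h))
  α⇐-natural = sym (cancelˡ α-isoʳ) ○ (refl⟩⨾⟨ (pullˡ (sym α-natural) ○ assoc ○ (refl⟩⨾⟨ α-isoˡ) ○ identityʳ))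

  α⇒-natural₃ : ∀ {X Y Z Z′} {h : Z ⇒ Z′} → ((id {X ⊗₀ Y} ⊗₁ h) ⨾ α⇒) ≈ (α⇒ ⨾ (id ⊗₁ (id ⊗₁ h)))
  α⇒-natural₃ = ((sym ⊗-identity ⟩⊗⟨ refl) ⟩⨾⟨refl) ○ α-natural

  α⇒-natural₁ : ∀ {X Y Z X′} {f : X ⇒ X′} → (((f ⊗₁ id {Y}) ⊗₁ id {Z}) ⨾ α⇒) ≈ (α⇒ ⨾ (f ⊗₁ id))
  α⇒-natural₁ = α-natural ○ (refl⟩⨾⟨ (refl ⟩⊗⟨ ⊗-identity))

  α⇐-natural₁ : ∀ {X X′ Y Z} {f : X ⇒ X′} → ((f ⊗₁ id {Y ⊗₀ Z}) ⨾ α⇐) ≈ (α⇐ ⨾ ((f ⊗₁ id) ⊗₁ id))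
  α⇐-natural₁ = ((refl ⟩⊗⟨ sym ⊗-identity) ⟩⨾⟨refl) ○ α⇐-natural

  unitorˡ⇐-natural : ∀ {X Y} {f : X ⇒ Y} → (f ⨾ unitorˡ⇐) ≈ (unitorˡ⇐ ⨾ (id ⊗₁ f))
  unitorˡ⇐-natural = sym (cancelˡ unitorˡ-isoʳ)
    ○ (refl⟩⨾⟨ (pullˡ (sym unitorˡ-natural) ○ assoc ○ (refl⟩⨾⟨ unitorˡ-isoˡ) ○ identityʳ))

  unitorʳ⇐-natural : ∀ {X Y} {f : X ⇒ Y} → (f ⨾ unitorʳ⇐) ≈ (unitorʳ⇐ ⨾ (f ⊗₁ id))
  unitorʳ⇐-natural = sym (cancelˡ unitorʳ-isoʳ)
    ○ (refl⟩⨾⟨ (pullˡ (sym unitorʳ-natural) ○ assoc ○ (refl⟩⨾⟨ unitorʳ-isoˡ) ○ identityʳ))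

  unit⊗-faithful : ∀ {X Y} {f g : X ⇒ Y} → (id {unit} ⊗₁ f) ≈ (id ⊗₁ g) → f ≈ g
  unit⊗-faithful p = cancel-splitEpi unitorˡ-isoʳ (sym unitorˡ-natural ○ (p ⟩⨾⟨refl) ○ unitorˡ-natural)

  ⊗unit-faithful : ∀ {X Y} {f g : X ⇒ Y} → (f ⊗₁ id {unit}) ≈ (g ⊗₁ id) → f ≈ g
  ⊗unit-faithful p = cancel-splitEpi unitorʳ-isoʳ (sym unitorʳ-natural ○ (p ⟩⨾⟨refl) ○ unitorʳ-natural)

  unitorˡ-unit⊗ : ∀ {X} → unitorˡ⇒ {unit ⊗₀ X} ≈ (id ⊗₁ unitorˡ⇒)
  unitorˡ-unit⊗ = cancel-splitMono unitorˡ-isoˡ (sym unitorˡ-natural)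

  α⇒⨾unitorˡ : ∀ {X Y} → (α⇒ {unit} {X} {Y} ⨾ unitorˡ⇒) ≈ (unitorˡ⇒ ⊗₁ id)
  α⇒⨾unitorˡ {X} {Y} =
    unit⊗-faithful (cancel-splitEpi α-isoʳ
      (cancel-splitEpi (⊗id-inverse α-isoʳ) (via-pentagon ○ sym via-naturality)))
    where
    via-pentagon : ((α⇒ {unit} {unit} {X} ⊗₁ id {Y}) ⨾ α⇒ ⨾ (id ⊗₁ (α⇒ ⨾ unitorˡ⇒)))
                   ≈ (((unitorʳ⇒ ⊗₁ id) ⊗₁ id) ⨾ α⇒)
    via-pentagon = (refl⟩⨾⟨ refl⟩⨾⟨ id⊗-homo) ○ (refl⟩⨾⟨ sym-assoc) ○ extendˡ pentagon
      ○ (refl⟩⨾⟨ triangle) ○ (refl⟩⨾⟨ (refl ⟩⊗⟨ sym ⊗-identity)) ○ sym α-natural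
    via-naturality : ((α⇒ {unit} {unit} {X} ⊗₁ id {Y}) ⨾ α⇒ ⨾ (id ⊗₁ (unitorˡ⇒ ⊗₁ id)))
                     ≈ (((unitorʳ⇒ ⊗₁ id) ⊗₁ id) ⨾ α⇒)
    via-naturality = (refl⟩⨾⟨ sym α-natural) ○ pullˡ (⊗-merge ○ (triangle ⟩⊗⟨ identityˡ))

  α⇒⨾id⊗unitorʳ : ∀ {X Y} → (α⇒ {X} {Y} {unit} ⨾ (id ⊗₁ unitorʳ⇒)) ≈ unitorʳ⇒
  α⇒⨾id⊗unitorʳ {X} {Y} = ⊗unit-faithful (cancel-splitMono α-isoˡ via-pentagon)
    where
    via-pentagon : (((α⇒ {X} {Y} {unit} ⨾ (id ⊗₁ unitorʳ⇒)) ⊗₁ id {unit}) ⨾ α⇒) ≈ ((unitorʳ⇒ ⊗₁ id) ⨾ α⇒)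
    via-pentagon = (⊗id-homo ⟩⨾⟨refl) ○ assoc ○ (refl⟩⨾⟨ α-natural)
      ○ (refl⟩⨾⟨ refl⟩⨾⟨ ((refl ⟩⊗⟨ sym triangle) ○ id⊗-homo))
      ○ (refl⟩⨾⟨ sym-assoc) ○ extendˡ pentagon
      ○ (refl⟩⨾⟨ sym α-natural) ○ (refl⟩⨾⟨ ((⊗-identity ⟩⊗⟨ refl) ⟩⨾⟨refl)) ○ pullˡ triangle

  α⇐⨾unitorʳ : ∀ {X Y} → (α⇐ {X} {Y} {unit} ⨾ unitorʳ⇒) ≈ (id ⊗₁ unitorʳ⇒)
  α⇐⨾unitorʳ = (refl⟩⨾⟨ sym α⇒⨾id⊗unitorʳ) ○ cancelˡ α-isoʳ

  α⇐⨾unitorʳ⊗id : ∀ {X Y} → (α⇐ {X} {unit} {Y} ⨾ (unitorʳ⇒ ⊗₁ id)) ≈ (id ⊗₁ unitorˡ⇒)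
  α⇐⨾unitorʳ⊗id = (refl⟩⨾⟨ sym triangle) ○ cancelˡ α-isoʳ

  unitorˡ⇐⊗id⨾α⇒ : ∀ {X Y} → ((unitorˡ⇐ ⊗₁ id {Y}) ⨾ α⇒) ≈ unitorˡ⇐ {X ⊗₀ Y}
  unitorˡ⇐⊗id⨾α⇒ = inverse-unique (assoc ○ (refl⟩⨾⟨ α⇒⨾unitorˡ) ○ ⊗id-inverse unitorˡ-isoʳ) unitorˡ-isoˡ refl

  unitorʳ⇐⊗id⨾α⇒⨾id⊗unitorˡ : ∀ {X Y} → ((unitorʳ⇐ {X} ⊗₁ id {Y}) ⨾ α⇒ ⨾ (id ⊗₁ unitorˡ⇒)) ≈ id
  unitorʳ⇐⊗id⨾α⇒⨾id⊗unitorˡ = (refl⟩⨾⟨ triangle) ○ ⊗id-inverse unitorʳ-isoʳ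

  unitorˡ≈unitorʳ : unitorˡ⇒ {unit} ≈ unitorʳ⇒ {unit}
  unitorˡ≈unitorʳ = ⊗unit-faithful (sym α⇒⨾unitorˡ ○ (refl⟩⨾⟨ unitorˡ-unit⊗) ○ triangle)

  unitorʳ⇐≈unitorˡ⇐ : unitorʳ⇐ {unit} ≈ unitorˡ⇐
  unitorʳ⇐≈unitorˡ⇐ = inverse-unique unitorʳ-isoʳ unitorˡ-isoˡ (sym unitorˡ≈unitorʳ)

module BalancedCoherence {o ℓ e} (𝐂 : BalancedMonoidalCategory o ℓ e) where
  open BalancedMonoidalCategory 𝐂
  open HomReasoning 𝐂
  open MonoidalCoherence 𝐂

  σ⨾unitorˡ : ∀ {X} → (σ {X} {unit} ⨾ unitorˡ⇒) ≈ unitorʳ⇒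
  σ⨾unitorˡ {X} = sym (⊗unit-faithful (cancel-splitMono σ-isoˡ via-hexagon))
    where
    via-hexagon : ((unitorʳ⇒ ⊗₁ id {unit}) ⨾ σ) ≈ (((σ {X} {unit} ⨾ unitorˡ⇒) ⊗₁ id) ⨾ σ)
    via-hexagon = (sym triangle ⟩⨾⟨refl) ○ assoc ○ (refl⟩⨾⟨ σ-natural) ○ (refl⟩⨾⟨ refl⟩⨾⟨ sym α⇒⨾unitorˡ)
      ○ (refl⟩⨾⟨ sym-assoc) ○ extendˡ hexagon₁ ○ (refl⟩⨾⟨ assoc)
      ○ (refl⟩⨾⟨ refl⟩⨾⟨ unitorˡ-natural) ○ (refl⟩⨾⟨ pullˡ α⇒⨾unitorˡ)
      ○ pullˡ (⊗-merge ○ (refl ⟩⊗⟨ identityˡ))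

  σ⨾unitorʳ : ∀ {X} → (σ {unit} {X} ⨾ unitorʳ⇒) ≈ unitorˡ⇒
  σ⨾unitorʳ {X} = sym (unit⊗-faithful (cancel-splitMono σ-isoˡ via-hexagon))
    where
    via-hexagon : ((id {unit} ⊗₁ unitorˡ⇒) ⨾ σ) ≈ ((id ⊗₁ (σ {unit} {X} ⨾ unitorʳ⇒)) ⨾ σ)
    via-hexagon = (sym α⇐⨾unitorʳ⊗id ⟩⨾⟨refl) ○ assoc ○ (refl⟩⨾⟨ σ-natural) ○ (refl⟩⨾⟨ refl⟩⨾⟨ sym α⇐⨾unitorʳ)
      ○ (refl⟩⨾⟨ sym-assoc) ○ extendˡ hexagon₂ ○ (refl⟩⨾⟨ assoc)
      ○ (refl⟩⨾⟨ refl⟩⨾⟨ unitorʳ-natural) ○ (refl⟩⨾⟨ pullˡ α⇐⨾unitorʳ) ○ pullˡ (sym id⊗-homo)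

  σ-unit : σ {unit} {unit} ≈ id
  σ-unit = cancel-splitMono unitorˡ-isoˡ (σ⨾unitorˡ ○ sym unitorˡ≈unitorʳ ○ sym identityˡ)

  -- θ_I is an idempotent isomorphism: θ_{I⊗I} = θ_I ⊗ θ_I by balance, since σ_{I,I} = id.
  θ-unit : θ {unit} ≈ id
  θ-unit = sym (cancel-splitEpi θ-isoʳ (identityʳ ○ cancel-splitEpi unitorˡ-isoʳ idempotent))
    where
    idempotent : (unitorˡ⇒ ⨾ θ) ≈ (unitorˡ⇒ ⨾ θ ⨾ θ)
    idempotent = θ-natural ○ (balance ⟩⨾⟨refl) ○ ((σ-unit ⟩⨾⟨ (refl⟩⨾⟨ σ-unit)) ⟩⨾⟨refl)
      ○ ((identityˡ ○ identityʳ) ⟩⨾⟨refl) ○ (serialize₁₂ ⟩⨾⟨refl) ○ assoc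
      ○ (refl⟩⨾⟨ unitorˡ-natural) ○ (refl⟩⨾⟨ (unitorˡ≈unitorʳ ⟩⨾⟨refl)) ○ pullˡ unitorʳ-natural
      ○ assoc ○ (sym unitorˡ≈unitorʳ ⟩⨾⟨refl)

  σ⁻¹-natural : ∀ {X Y X′ Y′} {f : X ⇒ X′} {g : Y ⇒ Y′} → ((f ⊗₁ g) ⨾ σ⁻¹) ≈ (σ⁻¹ ⨾ (g ⊗₁ f))
  σ⁻¹-natural = sym (cancelˡ σ-isoʳ) ○ (refl⟩⨾⟨ extendˡ (sym σ-natural))
    ○ (refl⟩⨾⟨ ((refl⟩⨾⟨ σ-isoˡ) ○ identityʳ))

  θ⁻¹-natural : ∀ {X Y} {f : X ⇒ Y} → (f ⨾ θ⁻¹) ≈ (θ⁻¹ ⨾ f)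
  θ⁻¹-natural = sym (cancelˡ θ-isoʳ) ○ (refl⟩⨾⟨ extendˡ (sym θ-natural))
    ○ (refl⟩⨾⟨ ((refl⟩⨾⟨ θ-isoˡ) ○ identityʳ))

  braid : Sign → ∀ {X Y} → X ⊗₀ Y ⇒ Y ⊗₀ X
  braid plus  = σ
  braid minus = σ⁻¹

  σ±≈braid : ∀ s {X} → σ± {X} s ≈ braid s
  σ±≈braid plus  = refl
  σ±≈braid minus = refl

  braid-natural : ∀ s {X Y X′ Y′} {f : X ⇒ X′} {g : Y ⇒ Y′} → ((f ⊗₁ g) ⨾ braid s) ≈ (braid s ⨾ (g ⊗₁ f))
  braid-natural plus  = σ-natural
  braid-natural minus = σ⁻¹-natural

  braid-inverse : ∀ s {X Y} → (braid s {X} {Y} ⨾ braid (opp s)) ≈ id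
  braid-inverse plus  = σ-isoˡ
  braid-inverse minus = σ-isoʳ

  braid-hexagon : ∀ s {X Y Z} → ((braid s {X} {Y} ⊗₁ id {Z}) ⨾ α⇒ ⨾ (id ⊗₁ braid s)) ≈ (α⇒ ⨾ braid s ⨾ α⇒)
  braid-hexagon plus  = sym hexagon₁
  braid-hexagon minus = sym (inverse-unique
    (⨾₃-inverse α-isoˡ σ-isoʳ α-isoˡ) (⨾₃-inverse (⊗id-inverse σ-isoˡ) α-isoʳ (id⊗-inverse σ-isoˡ)) hexagon₂)

  braid⨾unitorʳ : ∀ s {X} → (braid s {unit} {X} ⨾ unitorʳ⇒) ≈ unitorˡ⇒
  braid⨾unitorʳ plus  = σ⨾unitorʳ
  braid⨾unitorʳ minus = (refl⟩⨾⟨ sym σ⨾unitorˡ) ○ cancelˡ σ-isoʳ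

  unitorˡ⇐⨾braid : ∀ s {X} → (unitorˡ⇐ ⨾ braid s {unit} {X}) ≈ unitorʳ⇐
  unitorˡ⇐⨾braid s = inverse-unique (assoc ○ (refl⟩⨾⟨ braid⨾unitorʳ s) ○ unitorˡ-isoʳ) unitorʳ-isoˡ refl

  θ±-natural : ∀ s {X Y} {f : X ⇒ Y} → (f ⨾ θ± s) ≈ (θ± s ⨾ f)
  θ±-natural plus  = θ-natural
  θ±-natural minus = θ⁻¹-natural

  θ±-inverse : ∀ s {X} → (θ± {X} s ⨾ θ± (opp s)) ≈ id
  θ±-inverse plus  = θ-isoˡ
  θ±-inverse minus = θ-isoʳ

  θ±-unit : ∀ s → θ± {unit} s ≈ id
  θ±-unit plus  = θ-unit
  θ±-unit minus = inverse-unique θ-isoʳ identityˡ θ-unit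

  θ±-balance : ∀ s {X Y} → θ± {X ⊗₀ Y} s ≈ (braid s {X} {Y} ⨾ (θ± s ⊗₁ θ± s) ⨾ braid s)
  θ±-balance plus  = balance
  θ±-balance minus = inverse-unique θ-isoʳ (⨾₃-inverse σ-isoˡ (⊗-inverse θ-isoˡ θ-isoˡ) σ-isoˡ) balance

module Reassociation {o ℓ e} (𝐂 : BalancedMonoidalCategory o ℓ e) where
  open BalancedMonoidalCategory 𝐂
  open HomReasoning 𝐂
  open MonoidalCoherence 𝐂
  open BalancedCoherence 𝐂

  on₂₃ : ∀ {X Y Z Y′ Z′} → Y ⊗₀ Z ⇒ Y′ ⊗₀ Z′ → (X ⊗₀ Y) ⊗₀ Z ⇒ (X ⊗₀ Y′) ⊗₀ Z′
  on₂₃ g = α⇒ ⨾ (id ⊗₁ g) ⨾ α⇐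

  assoc₃ : ∀ {V W X Y Z} {a : V ⇒ W} {b : W ⇒ X} {c : X ⇒ Y} {r : Y ⇒ Z} →
           ((a ⨾ b ⨾ c) ⨾ r) ≈ (a ⨾ b ⨾ c ⨾ r)
  assoc₃ = assoc ○ (refl⟩⨾⟨ assoc)

  id⊗-merge₃ : ∀ {V X Y Z W T} {a : X ⇒ Y} {b : Y ⇒ Z} {c : Z ⇒ W} {r : V ⊗₀ W ⇒ T} →
               ((id ⊗₁ a) ⨾ (id ⊗₁ b) ⨾ (id ⊗₁ c) ⨾ r) ≈ ((id ⊗₁ (a ⨾ b ⨾ c)) ⨾ r)
  id⊗-merge₃ = (refl⟩⨾⟨ pullˡ (sym id⊗-homo)) ○ pullˡ (sym id⊗-homo)

  pentagonˡ : ∀ {V W X Y T} {r : V ⊗₀ (W ⊗₀ (X ⊗₀ Y)) ⇒ T} →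
              ((α⇒ {V} {W} {X} ⊗₁ id {Y}) ⨾ α⇒ ⨾ (id ⊗₁ α⇒) ⨾ r) ≈ (α⇒ ⨾ α⇒ ⨾ r)
  pentagonˡ = (refl⟩⨾⟨ sym-assoc) ○ extendˡ pentagon

  α⇐⨾α⇒⊗id⨾α⇒ : ∀ {V W X Y T} {r : V ⊗₀ ((W ⊗₀ X) ⊗₀ Y) ⇒ T} →
                 (α⇐ ⨾ (α⇒ {V} {W} {X} ⊗₁ id {Y}) ⨾ α⇒ ⨾ r) ≈ (α⇒ ⨾ (id ⊗₁ α⇐) ⨾ r)
  α⇐⨾α⇒⊗id⨾α⇒ {V} {W} {X} {Y} =
    (refl⟩⨾⟨ ((refl⟩⨾⟨ refl⟩⨾⟨ sym (cancelˡ (id⊗-inverse {V} (α-isoˡ {W} {X} {Y})))) ○ pentagonˡ))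
    ○ cancelˡ α-isoʳ

  on₂₃-reassoc : ∀ {P X Y Z Y′ Z′ T} {g : Y ⊗₀ Z ⇒ Y′ ⊗₀ Z′} {r : P ⊗₀ ((X ⊗₀ Y′) ⊗₀ Z′) ⇒ T} →
                 (α⇒ {P ⊗₀ X} ⨾ (id ⊗₁ g) ⨾ α⇐ ⨾ (α⇒ ⊗₁ id) ⨾ α⇒ ⨾ r)
                   ≈ ((α⇒ ⊗₁ id) ⨾ α⇒ ⨾ (id ⊗₁ on₂₃ g) ⨾ r)
  on₂₃-reassoc = (refl⟩⨾⟨ refl⟩⨾⟨ α⇐⨾α⇒⊗id⨾α⇒) ○ (refl⟩⨾⟨ extendˡ α⇒-natural₃) ○ sym pentagonˡ
    ○ (refl⟩⨾⟨ refl⟩⨾⟨ id⊗-merge₃)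

  on₂₃⊗id-reassoc : ∀ {P X Y X′ Y′ Z T} {g : X ⊗₀ Y ⇒ X′ ⊗₀ Y′} {r : P ⊗₀ ((X′ ⊗₀ Y′) ⊗₀ Z) ⇒ T} →
                    ((α⇒ {P} ⊗₁ id {Z}) ⨾ ((id ⊗₁ g) ⊗₁ id) ⨾ (α⇐ ⊗₁ id) ⨾ (α⇒ ⊗₁ id) ⨾ α⇒ ⨾ r)
                      ≈ ((α⇒ ⊗₁ id) ⨾ α⇒ ⨾ (id ⊗₁ (g ⊗₁ id)) ⨾ r)
  on₂₃⊗id-reassoc = (refl⟩⨾⟨ refl⟩⨾⟨ cancelˡ (⊗id-inverse α-isoʳ)) ○ (refl⟩⨾⟨ extendˡ α-natural)

  on₂₃-natural₁ : ∀ {P P′ Y Z T} {h : P ⇒ P′} {g : Y ⊗₀ Z ⇒ Y ⊗₀ Z} {r : (P′ ⊗₀ Y) ⊗₀ Z ⇒ T} →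
                  (((h ⊗₁ id) ⊗₁ id) ⨾ α⇒ ⨾ (id ⊗₁ g) ⨾ α⇐ ⨾ r)
                    ≈ (α⇒ ⨾ (id ⊗₁ g) ⨾ α⇐ ⨾ ((h ⊗₁ id) ⊗₁ id) ⨾ r)
  on₂₃-natural₁ = extendˡ α⇒-natural₁ ○ (refl⟩⨾⟨ extendˡ ⊗-slide) ○ (refl⟩⨾⟨ refl⟩⨾⟨ extendˡ α⇐-natural₁)

  braid-hexagonˡ : ∀ s {X Y Z T} {r : Y ⊗₀ (Z ⊗₀ X) ⇒ T} →
                   ((braid s {X} {Y} ⊗₁ id {Z}) ⨾ α⇒ ⨾ (id ⊗₁ braid s) ⨾ r) ≈ (α⇒ ⨾ braid s ⨾ α⇒ ⨾ r)
  braid-hexagonˡ s = (refl⟩⨾⟨ sym-assoc) ○ sym-assoc ○ (braid-hexagon s ⟩⨾⟨refl) ○ assoc₃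

  braid-hexagon-α⇐ : ∀ s {X Y Z} → ((braid s {X} {Y} ⊗₁ id {Z}) ⨾ α⇒ ⨾ (id ⊗₁ braid s) ⨾ α⇐) ≈ (α⇒ ⨾ braid s)
  braid-hexagon-α⇐ s = braid-hexagonˡ s ○ (refl⟩⨾⟨ refl⟩⨾⟨ α-isoˡ) ○ (refl⟩⨾⟨ identityʳ)

  yang-baxter : ∀ s {X Y Z} →
                (on₂₃ (braid s) ⨾ (braid s ⊗₁ id) ⨾ on₂₃ (braid s))
                  ≈ ((braid s ⊗₁ id) ⨾ on₂₃ (braid s) ⨾ (braid s {Y} {X} ⊗₁ id {Z}))
  yang-baxter s = assoc₃ ○ (refl⟩⨾⟨ refl⟩⨾⟨ refl⟩⨾⟨ braid-hexagonˡ s) ○ (refl⟩⨾⟨ refl⟩⨾⟨ cancelˡ α-isoʳ)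
    ○ (refl⟩⨾⟨ refl⟩⨾⟨ refl⟩⨾⟨ α-isoˡ) ○ (refl⟩⨾⟨ refl⟩⨾⟨ identityʳ)
    ○ sym ((refl⟩⨾⟨ assoc₃) ○ braid-hexagonˡ s ○ (refl⟩⨾⟨ refl⟩⨾⟨ cancelˡ α-isoˡ)
      ○ (refl⟩⨾⟨ sym (braid-natural s)))

  α-round-trip : ∀ {W X Y Z T} {r : ((W ⊗₀ X) ⊗₀ Y) ⊗₀ Z ⇒ T} →
                 r ≈ ((α⇒ ⊗₁ id) ⨾ α⇒ ⨾ α⇐ ⨾ (α⇐ ⊗₁ id) ⨾ r)
  α-round-trip = sym ((refl⟩⨾⟨ cancelˡ α-isoˡ) ○ cancelˡ (⊗id-inverse α-isoˡ))

  yang-baxter₂₃₄ : ∀ s {W X T} {r : ((W ⊗₀ X) ⊗₀ X) ⊗₀ X ⇒ T} →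
    (α⇒ ⨾ (id ⊗₁ braid s) ⨾ α⇐ ⨾ (α⇒ ⊗₁ id) ⨾ ((id ⊗₁ braid s) ⊗₁ id) ⨾ (α⇐ ⊗₁ id)
      ⨾ α⇒ ⨾ (id ⊗₁ braid s) ⨾ α⇐ ⨾ r)
    ≈ ((α⇒ ⊗₁ id) ⨾ ((id ⊗₁ braid s) ⊗₁ id) ⨾ (α⇐ ⊗₁ id) ⨾ α⇒ ⨾ (id ⊗₁ braid s) ⨾ α⇐
      ⨾ (α⇒ ⊗₁ id) ⨾ ((id ⊗₁ braid s) ⊗₁ id) ⨾ (α⇐ ⊗₁ id) ⨾ r)
  yang-baxter₂₃₄ s = (refl⟩⨾⟨ refl⟩⨾⟨ refl⟩⨾⟨ refl⟩⨾⟨ refl⟩⨾⟨ refl⟩⨾⟨ refl⟩⨾⟨ refl⟩⨾⟨ refl⟩⨾⟨ α-round-trip)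
    ○ (refl⟩⨾⟨ refl⟩⨾⟨ refl⟩⨾⟨ refl⟩⨾⟨ refl⟩⨾⟨ refl⟩⨾⟨ on₂₃-reassoc)
    ○ (refl⟩⨾⟨ refl⟩⨾⟨ refl⟩⨾⟨ on₂₃⊗id-reassoc) ○ on₂₃-reassoc
    ○ (refl⟩⨾⟨ refl⟩⨾⟨ id⊗-merge₃) ○ (refl⟩⨾⟨ refl⟩⨾⟨ ((refl ⟩⊗⟨ yang-baxter s) ⟩⨾⟨refl))
    ○ sym ((refl⟩⨾⟨ refl⟩⨾⟨ refl⟩⨾⟨ refl⟩⨾⟨ refl⟩⨾⟨ refl⟩⨾⟨ refl⟩⨾⟨ refl⟩⨾⟨ refl⟩⨾⟨ α-round-trip)
      ○ (refl⟩⨾⟨ refl⟩⨾⟨ refl⟩⨾⟨ refl⟩⨾⟨ refl⟩⨾⟨ refl⟩⨾⟨ on₂₃⊗id-reassoc)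
      ○ (refl⟩⨾⟨ refl⟩⨾⟨ refl⟩⨾⟨ on₂₃-reassoc) ○ on₂₃⊗id-reassoc
      ○ (refl⟩⨾⟨ refl⟩⨾⟨ id⊗-merge₃))

module Application {o ℓ e} (𝐂 : BalancedMonoidalCategory o ℓ e) (R : ReflexiveObject 𝐂) where
  open BalancedMonoidalCategory 𝐂
  open ReflexiveObject R
  open Combinators 𝐂 R
  open HomReasoning 𝐂
  open MonoidalCoherence 𝐂
  open BalancedCoherence 𝐂

  uncur : ∀ {X} → X ⇒ A → X ⊗₀ A ⇒ A
  uncur f = (f ⊗₁ id) ⨾ app

  uncur-cur : ∀ {X} (h : X ⊗₀ A ⇒ A) → uncur (cur h) ≈ h
  uncur-cur = cur-β

  uncur-injective : ∀ {X} {f g : X ⇒ A} → uncur f ≈ uncur g → f ≈ g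
  uncur-injective {f = f} {g} p = cur-unique (uncur g) f p ○ sym (cur-unique (uncur g) g refl)

  uncur-resp-≈ : ∀ {X} {f g : X ⇒ A} → f ≈ g → uncur f ≈ uncur g
  uncur-resp-≈ p = (p ⟩⊗⟨ refl) ⟩⨾⟨refl

  uncur-natural : ∀ {X Y} {h : X ⇒ Y} {f : Y ⇒ A} → uncur (h ⨾ f) ≈ ((h ⊗₁ id) ⨾ uncur f)
  uncur-natural = (⊗id-homo ⟩⨾⟨refl) ○ assoc

  uncur-id : uncur id ≈ app
  uncur-id = (⊗-identity ⟩⨾⟨refl) ○ identityˡ

  act : Elem → A ⇒ A
  act a = unitorˡ⇐ ⨾ uncur a

  uncur≈unitorˡ⨾act : ∀ {a} → uncur a ≈ (unitorˡ⇒ ⨾ act a)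
  uncur≈unitorˡ⨾act = sym (cancelˡ unitorˡ-isoˡ)

  act-injective : ∀ {a b} → act a ≈ act b → a ≈ b
  act-injective p = uncur-injective (uncur≈unitorˡ⨾act ○ (refl⟩⨾⟨ p) ○ sym uncur≈unitorˡ⨾act)

  act-resp-≈ : ∀ {a b} → a ≈ b → act a ≈ act b
  act-resp-≈ p = refl⟩⨾⟨ uncur-resp-≈ p

  act-cur₀ : (f : A ⇒ A) → act (cur₀ f) ≈ f
  act-cur₀ f = (refl⟩⨾⟨ uncur-cur (unitorˡ⇒ ⨾ f)) ○ cancelˡ unitorˡ-isoʳ

  ·≈⨾act : ∀ {a b} → (a · b) ≈ (b ⨾ act a)
  ·≈⨾act = (refl⟩⨾⟨ ((serialize₂₁ ⟩⨾⟨refl) ○ assoc)) ○ pullˡ (sym unitorˡ⇐-natural) ○ assoc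

  insert : ∀ {X} → Elem → X ⇒ A ⊗₀ X
  insert a = unitorˡ⇐ ⨾ (a ⊗₁ id)

  act-⨾ : ∀ {b} {h : A ⇒ A} → act (b ⨾ h) ≈ (insert b ⨾ uncur h)
  act-⨾ = (refl⟩⨾⟨ uncur-natural) ○ sym-assoc

  act-· : ∀ {a b} → act (a · b) ≈ (insert b ⨾ uncur (act a))
  act-· = act-resp-≈ ·≈⨾act ○ act-⨾

  insert⊗id⨾α⇒ : ∀ {X Y a} → ((insert {X} a ⊗₁ id {Y}) ⨾ α⇒) ≈ insert a
  insert⊗id⨾α⇒ = (⊗id-homo ⟩⨾⟨refl) ○ assoc ○ (refl⟩⨾⟨ α-natural) ○ pullˡ unitorˡ⇐⊗id⨾α⇒
    ○ (refl⟩⨾⟨ (refl ⟩⊗⟨ ⊗-identity))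

  insert⨾α⇐ : ∀ {X Y a} → (insert {X ⊗₀ Y} a ⨾ α⇐) ≈ (insert a ⊗₁ id)
  insert⨾α⇐ = (sym insert⊗id⨾α⇒ ⟩⨾⟨refl) ○ assoc ○ (refl⟩⨾⟨ α-isoˡ) ○ identityʳ

  insert-natural : ∀ {X Y a} {f : X ⇒ Y} → (insert a ⨾ (id ⊗₁ f)) ≈ (f ⨾ insert a)
  insert-natural = assoc ○ (refl⟩⨾⟨ ⊗-slide) ○ pullˡ (sym unitorˡ⇐-natural) ○ assoc

  insert⨾app : ∀ {a} → (insert a ⨾ app) ≈ act a
  insert⨾app = assoc

  global-elements-commute : ∀ {b c : Elem} → (c ⨾ unitorʳ⇐ ⨾ (id ⊗₁ b)) ≈ (b ⨾ insert c)
  global-elements-commute = pullˡ unitorʳ⇐-natural ○ assoc ○ (refl⟩⨾⟨ sym serialize₁₂)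
    ○ (unitorʳ⇐≈unitorˡ⇐ ⟩⨾⟨refl) ○ (refl⟩⨾⟨ serialize₂₁) ○ sym (pullˡ unitorˡ⇐-natural ○ assoc)

  insert⨾σ± : ∀ s {a} → (insert a ⨾ σ± s) ≈ (unitorʳ⇐ ⨾ (id ⊗₁ a))
  insert⨾σ± s = (refl⟩⨾⟨ σ±≈braid s) ○ assoc ○ (refl⟩⨾⟨ braid-natural s) ○ pullˡ (unitorˡ⇐⨾braid s)

module CombinatorEquations {o ℓ e} (𝐂 : BalancedMonoidalCategory o ℓ e) (R : ReflexiveObject 𝐂) where
  open BalancedMonoidalCategory 𝐂
  open ReflexiveObject R
  open Combinators 𝐂 R
  open HomReasoning 𝐂
  open MonoidalCoherence 𝐂
  open BalancedCoherence 𝐂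
  open Reassociation 𝐂
  open Application 𝐂 R

  𝐁₃ : (A ⊗₀ A) ⊗₀ A ⇒ A
  𝐁₃ = α⇒ ⨾ (id ⊗₁ app) ⨾ app

  𝐁₂ : A ⊗₀ A ⇒ A
  𝐁₂ = cur 𝐁₃

  𝐂±₃ : Sign → (A ⊗₀ A) ⊗₀ A ⇒ A
  𝐂±₃ s = α⇒ ⨾ (id ⊗₁ σ± s) ⨾ α⇐ ⨾ (app ⊗₁ id) ⨾ app

  𝐂±₂ : Sign → A ⊗₀ A ⇒ A
  𝐂±₂ s = cur (𝐂±₃ s)

  uncur-act-𝐁 : uncur (act 𝐁) ≈ 𝐁₂
  uncur-act-𝐁 = uncur-resp-≈ (act-cur₀ (cur 𝐁₂)) ○ uncur-cur 𝐁₂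

  uncur-𝐁₂ : uncur 𝐁₂ ≈ 𝐁₃
  uncur-𝐁₂ = uncur-cur 𝐁₃

  uncur-act-𝐂± : ∀ s → uncur (act (𝐂± s)) ≈ 𝐂±₂ s
  uncur-act-𝐂± s = uncur-resp-≈ (act-cur₀ (cur (𝐂±₂ s))) ○ uncur-cur (𝐂±₂ s)

  uncur-𝐂±₂ : ∀ s → uncur (𝐂±₂ s) ≈ 𝐂±₃ s
  uncur-𝐂±₂ s = uncur-cur (𝐂±₃ s)

  uncur-act-𝛉± : ∀ s → uncur (act (𝛉± s)) ≈ ((id ⊗₁ θ± s) ⨾ app)
  uncur-act-𝛉± s = uncur-resp-≈ (act-cur₀ _) ○ uncur-cur _

  act-𝐈 : act 𝐈 ≈ id
  act-𝐈 = act-cur₀ id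

  𝐁₃-β : ∀ {X Y} {f : X ⇒ A} {g : Y ⇒ A} → (((f ⊗₁ g) ⊗₁ id) ⨾ 𝐁₃) ≈ (α⇒ ⨾ (id ⊗₁ uncur g) ⨾ uncur f)
  𝐁₃-β = extendˡ α-natural ○ (refl⟩⨾⟨ pullˡ ⊗-merge) ○ (refl⟩⨾⟨ ((identityʳ ⟩⊗⟨ refl) ⟩⨾⟨refl))
    ○ (refl⟩⨾⟨ (serialize₂₁ ⟩⨾⟨refl)) ○ (refl⟩⨾⟨ assoc)

  𝐂±₃-β : ∀ s {X Y} {f : X ⇒ A} {g : Y ⇒ A} →
          (((f ⊗₁ g) ⊗₁ id) ⨾ 𝐂±₃ s) ≈ (α⇒ ⨾ (id ⊗₁ braid s) ⨾ α⇐ ⨾ (uncur f ⊗₁ g) ⨾ app)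
  𝐂±₃-β s = extendˡ α-natural
    ○ (refl⟩⨾⟨ extendˡ (⊗-merge
        ○ ((identityʳ ○ sym identityˡ) ⟩⊗⟨ ((refl⟩⨾⟨ σ±≈braid s) ○ braid-natural s)) ○ sym ⊗-merge))
    ○ (refl⟩⨾⟨ refl⟩⨾⟨ extendˡ α⇐-natural) ○ (refl⟩⨾⟨ refl⟩⨾⟨ refl⟩⨾⟨ pullˡ (⊗-merge ○ (refl ⟩⊗⟨ identityʳ)))

  uncur-act-𝐁· : ∀ {a} → uncur (act (𝐁 · a)) ≈ (app ⨾ act a)
  uncur-act-𝐁· = uncur-resp-≈ (act-· ○ (refl⟩⨾⟨ uncur-act-𝐁)) ○ uncur-natural ○ (refl⟩⨾⟨ uncur-𝐁₂)
    ○ pullˡ insert⊗id⨾α⇒ ○ pullˡ insert-natural ○ assoc ○ (refl⟩⨾⟨ insert⨾app)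

  act-𝐁·· : ∀ {a b} → act ((𝐁 · a) · b) ≈ (act b ⨾ act a)
  act-𝐁·· = act-· ○ (refl⟩⨾⟨ uncur-act-𝐁·) ○ sym-assoc ○ (insert⨾app ⟩⨾⟨refl)

  uncur-act-𝐂±· : ∀ s {a} → uncur (act (𝐂± s · a)) ≈ (σ± s ⨾ uncur (act a))
  uncur-act-𝐂±· s = uncur-resp-≈ (act-· ○ (refl⟩⨾⟨ uncur-act-𝐂± s)) ○ uncur-natural ○ (refl⟩⨾⟨ uncur-𝐂±₂ s)
    ○ pullˡ insert⊗id⨾α⇒ ○ pullˡ insert-natural ○ assoc
    ○ (refl⟩⨾⟨ pullˡ insert⨾α⇐) ○ (refl⟩⨾⟨ pullˡ (sym ⊗id-homo)) ○ (refl⟩⨾⟨ ((insert⨾app ⟩⊗⟨ refl) ⟩⨾⟨refl))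

  act-𝐂±·· : ∀ s {a b} → act ((𝐂± s · a) · b) ≈ (unitorʳ⇐ ⨾ (id ⊗₁ b) ⨾ uncur (act a))
  act-𝐂±·· s = act-· ○ (refl⟩⨾⟨ uncur-act-𝐂±· s) ○ pullˡ (insert⨾σ± s) ○ assoc

  uncur-act-𝐂±𝐁· : ∀ s {b} → uncur (act ((𝐂± s · 𝐁) · b)) ≈ ((id ⊗₁ act b) ⨾ app)
  uncur-act-𝐂±𝐁· s = uncur-resp-≈ (act-𝐂±·· s) ○ uncur-natural ○ (refl⟩⨾⟨ uncur-natural)
    ○ (refl⟩⨾⟨ refl⟩⨾⟨ (uncur-resp-≈ uncur-act-𝐁 ○ uncur-𝐁₂))
    ○ (refl⟩⨾⟨ extendˡ α-natural) ○ (refl⟩⨾⟨ refl⟩⨾⟨ pullˡ (sym id⊗-homo))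
    ○ (refl⟩⨾⟨ refl⟩⨾⟨ ((refl ⟩⊗⟨ uncur≈unitorˡ⨾act) ⟩⨾⟨refl)) ○ (refl⟩⨾⟨ refl⟩⨾⟨ (id⊗-homo ⟩⨾⟨refl))
    ○ (refl⟩⨾⟨ refl⟩⨾⟨ assoc) ○ (refl⟩⨾⟨ sym-assoc) ○ sym-assoc
    ○ (unitorʳ⇐⊗id⨾α⇒⨾id⊗unitorˡ ⟩⨾⟨refl) ○ identityˡ

  𝐂±₃≈braid-form : ∀ s → 𝐂±₃ s ≈ (α⇒ ⨾ (id ⊗₁ braid s) ⨾ α⇐ ⨾ uncur app)
  𝐂±₃≈braid-form s = refl⟩⨾⟨ ((refl ⟩⊗⟨ σ±≈braid s) ⟩⨾⟨refl)

  act-𝐁𝐈 : act (𝐁 · 𝐈) ≈ id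
  act-𝐁𝐈 = uncur-injective (uncur-act-𝐁· ○ (refl⟩⨾⟨ act-𝐈) ○ identityʳ ○ sym uncur-id)

  uncur-act-𝐁𝐁𝐈 : uncur (act (𝐁 · (𝐁 · 𝐈))) ≈ app
  uncur-act-𝐁𝐁𝐈 = uncur-act-𝐁· ○ (refl⟩⨾⟨ act-𝐁𝐈) ○ identityʳ

  uncur-𝐁₃ : uncur 𝐁₃ ≈ ((α⇒ ⊗₁ id) ⨾ ((id ⊗₁ app) ⊗₁ id) ⨾ uncur app)
  uncur-𝐁₃ = uncur-natural ○ (refl⟩⨾⟨ uncur-natural)

  𝐁₃-pentagon : ((α⇒ ⊗₁ id) ⨾ α⇒ ⨾ (id ⊗₁ 𝐁₃) ⨾ app) ≈ (α⇒ ⨾ (id ⊗₁ app) ⨾ 𝐁₃)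
  𝐁₃-pentagon = (refl⟩⨾⟨ refl⟩⨾⟨ (((id⊗-homo ○ (refl⟩⨾⟨ id⊗-homo)) ⟩⨾⟨refl) ○ assoc₃))
    ○ pentagonˡ ○ sym (refl⟩⨾⟨ extendˡ α⇒-natural₃)

  ⨾act𝐁⊗⨾app : ∀ {X Y} {f : X ⇒ A} {g : Y ⇒ A} → (((f ⨾ act 𝐁) ⊗₁ g) ⨾ app) ≈ ((f ⊗₁ g) ⨾ 𝐁₂)
  ⨾act𝐁⊗⨾app = ((refl ⟩⊗⟨ sym identityʳ) ⟩⨾⟨refl) ○ (⊗-homo ⟩⨾⟨refl) ○ assoc ○ (refl⟩⨾⟨ uncur-act-𝐁)

  act𝐁⊗id⊗id⨾𝐁₃ : (((act 𝐁 ⊗₁ id) ⊗₁ id) ⨾ 𝐁₃) ≈ (α⇒ ⨾ (id ⊗₁ app) ⨾ 𝐁₂)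
  act𝐁⊗id⊗id⨾𝐁₃ = 𝐁₃-β ○ (refl⟩⨾⟨ ((refl ⟩⊗⟨ uncur-id) ⟩⨾⟨ uncur-act-𝐁))

  uncur-α⇒⨾id⊗app⨾𝐁₂ : uncur (α⇒ ⨾ (id ⊗₁ app) ⨾ 𝐁₂) ≈ ((α⇒ ⊗₁ id) ⨾ α⇒ ⨾ (id ⊗₁ uncur app) ⨾ app)
  uncur-α⇒⨾id⊗app⨾𝐁₂ = uncur-natural ○ (refl⟩⨾⟨ uncur-natural) ○ (refl⟩⨾⟨ refl⟩⨾⟨ uncur-𝐁₂)
    ○ (refl⟩⨾⟨ 𝐁₃-β) ○ (refl⟩⨾⟨ refl⟩⨾⟨ refl⟩⨾⟨ uncur-id)

module Axioms {o ℓ e} (𝐂 : BalancedMonoidalCategory o ℓ e) (R : ReflexiveObject 𝐂) where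
  open BalancedMonoidalCategory 𝐂
  open ReflexiveObject R
  open Combinators 𝐂 R
  open HomReasoning 𝐂
  open MonoidalCoherence 𝐂
  open BalancedCoherence 𝐂
  open Reassociation 𝐂
  open Application 𝐂 R
  open CombinatorEquations 𝐂 R

  ·-cong : ∀ {a a′ b b′} → a ≈ a′ → b ≈ b′ → (a · b) ≈ (a′ · b′)
  ·-cong p q = refl⟩⨾⟨ ((p ⟩⊗⟨ q) ⟩⨾⟨refl)

  B-ax : ∀ a b c → (((𝐁 · a) · b) · c) ≈ (a · (b · c))
  B-ax a b c = begin
    ((𝐁 · a) · b) · c      ≈⟨ ·≈⨾act ⟩
    c ⨾ act ((𝐁 · a) · b)  ≈⟨ refl⟩⨾⟨ act-𝐁·· ⟩
    c ⨾ act b ⨾ act a      ≈⟨ pullˡ (sym ·≈⨾act) ⟩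
    (b · c) ⨾ act a        ≈⟨ ·≈⨾act ⟨
    a · (b · c)            ∎

  C-ax : ∀ s a b c → (((𝐂± s · a) · b) · c) ≈ ((a · c) · b)
  C-ax s a b c = begin
    ((𝐂± s · a) · b) · c                       ≈⟨ ·≈⨾act ⟩
    c ⨾ act ((𝐂± s · a) · b)                   ≈⟨ refl⟩⨾⟨ act-𝐂±·· s ⟩
    c ⨾ unitorʳ⇐ ⨾ (id ⊗₁ b) ⨾ uncur (act a)   ≈⟨ (refl⟩⨾⟨ sym-assoc) ○ sym-assoc ⟩
    (c ⨾ unitorʳ⇐ ⨾ (id ⊗₁ b)) ⨾ uncur (act a) ≈⟨ global-elements-commute ⟩⨾⟨refl ⟩
    (b ⨾ insert c) ⨾ uncur (act a)             ≈⟨ assoc ○ (refl⟩⨾⟨ sym act-·) ⟩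
    b ⨾ act (a · c)                            ≈⟨ ·≈⨾act ⟨
    (a · c) · b                                ∎

  I-ax : ∀ a → (𝐈 · a) ≈ a
  I-ax a = ·≈⨾act ○ (refl⟩⨾⟨ act-𝐈) ○ identityʳ

  C⁺≈C⁻ : ∀ a b → ((𝐂± plus · a) · b) ≈ ((𝐂± minus · a) · b)
  C⁺≈C⁻ a b = act-injective (act-𝐂±·· plus ○ sym (act-𝐂±·· minus))

  ext₁ : (𝐁 · 𝐈) ≈ 𝐈
  ext₁ = act-injective (act-𝐁𝐈 ○ sym act-𝐈)

  ext₂ : ∀ s → ((𝐂± s · 𝐁) · 𝐈) ≈ (𝐁 · 𝐈)
  ext₂ s = act-injective (uncur-injective (begin
    uncur (act ((𝐂± s · 𝐁) · 𝐈)) ≈⟨ uncur-act-𝐂±𝐁· s ⟩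
    (id ⊗₁ act 𝐈) ⨾ app          ≈⟨ ((refl ⟩⊗⟨ act-𝐈) ⟩⨾⟨refl) ○ uncur-id ⟩
    app                          ≈⟨ uncur-resp-≈ act-𝐁𝐈 ○ uncur-id ⟨
    uncur (act (𝐁 · 𝐈))          ∎))

  ext₄ : ∀ s → ((𝐁 · 𝐂± s) · 𝐂± (opp s)) ≈ (𝐁 · (𝐁 · 𝐈))
  ext₄ s = act-injective (act-𝐁·· ○ uncur-injective
    (uncur-natural ○ (refl⟩⨾⟨ uncur-act-𝐂± s) ○ uncur-injective braids-cancel ○ sym uncur-act-𝐁𝐁𝐈))
    where
    braids-cancel : uncur ((act (𝐂± (opp s)) ⊗₁ id) ⨾ 𝐂±₂ s) ≈ uncur app
    braids-cancel = uncur-natural ○ (refl⟩⨾⟨ uncur-𝐂±₂ s) ○ 𝐂±₃-β s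
      ○ (refl⟩⨾⟨ refl⟩⨾⟨ refl⟩⨾⟨ (uncur-resp-≈ (uncur-act-𝐂± (opp s)) ○ uncur-𝐂±₂ (opp s)))
      ○ (refl⟩⨾⟨ refl⟩⨾⟨ cancelˡ α-isoʳ)
      ○ (refl⟩⨾⟨ cancelˡ (id⊗-inverse ((refl⟩⨾⟨ σ±≈braid (opp s)) ○ braid-inverse s)))
      ○ cancelˡ α-isoˡ

  bal₂ : ∀ s → ((𝐁 · 𝛉± s) · 𝛉± (opp s)) ≈ (𝐁 · 𝐈)
  bal₂ s = act-injective (act-𝐁·· ○ uncur-injective (uncur-natural ○ (refl⟩⨾⟨ uncur-act-𝛉± s)
    ○ extendˡ ⊗-slide ○ (refl⟩⨾⟨ uncur-act-𝛉± (opp s)) ○ pullˡ (sym id⊗-homo)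
    ○ ((refl ⟩⊗⟨ θ±-inverse s) ⟩⨾⟨refl) ○ uncur-id ○ sym (uncur-resp-≈ act-𝐁𝐈 ○ uncur-id)))

  bal₃ : ∀ s t a → ((𝐂± s · 𝛉± t) · a) ≈ ((𝐂± s · 𝐈) · a)
  bal₃ s t a = act-injective (act-𝐂±·· s ○ (refl⟩⨾⟨ refl⟩⨾⟨ uncur-act-𝛉± t) ○ (refl⟩⨾⟨ pullˡ (sym id⊗-homo))
    ○ (refl⟩⨾⟨ ((refl ⟩⊗⟨ (θ±-natural t ○ (θ±-unit t ⟩⨾⟨refl) ○ identityˡ)) ⟩⨾⟨refl))
    ○ (refl⟩⨾⟨ refl⟩⨾⟨ sym (uncur-resp-≈ act-𝐈 ○ uncur-id)) ○ sym (act-𝐂±·· s))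

  ext₃ : ∀ s → ((𝐁 · ((𝐂± s · 𝐁) · 𝐁)) · ((𝐁 · 𝐁) · 𝐁)) ≈ ((𝐁 · (𝐁 · 𝐁)) · 𝐁)
  ext₃ s = act-injective (act-𝐁·· ○ (act-𝐁·· ⟩⨾⟨refl) ○ uncur-injective uncurried ○ sym act-𝐁··)
    where
    lhs₁ : uncur ((act 𝐁 ⨾ act 𝐁) ⨾ act ((𝐂± s · 𝐁) · 𝐁)) ≈ ((act 𝐁 ⊗₁ act 𝐁) ⨾ 𝐁₂)
    lhs₁ = uncur-natural ○ (refl⟩⨾⟨ uncur-act-𝐂±𝐁· s) ○ pullˡ (sym serialize₁₂) ○ ⨾act𝐁⊗⨾app
    rhs₁ : uncur (act 𝐁 ⨾ act (𝐁 · 𝐁)) ≈ (𝐁₂ ⨾ act 𝐁)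
    rhs₁ = uncur-natural ○ (refl⟩⨾⟨ uncur-act-𝐁·) ○ pullˡ uncur-act-𝐁
    lhs₂ : uncur ((act 𝐁 ⊗₁ act 𝐁) ⨾ 𝐁₂) ≈ (α⇒ ⨾ (id ⊗₁ 𝐁₂) ⨾ 𝐁₂)
    lhs₂ = uncur-natural ○ (refl⟩⨾⟨ uncur-𝐁₂) ○ 𝐁₃-β ○ (refl⟩⨾⟨ ((refl ⟩⊗⟨ uncur-act-𝐁) ⟩⨾⟨ uncur-act-𝐁))
    rhs₂ : uncur (𝐁₂ ⨾ act 𝐁) ≈ ((𝐁₂ ⊗₁ id) ⨾ 𝐁₂)
    rhs₂ = uncur-natural ○ (refl⟩⨾⟨ uncur-act-𝐁)
    by-pentagon : uncur (α⇒ ⨾ (id ⊗₁ 𝐁₂) ⨾ 𝐁₂) ≈ uncur ((𝐁₂ ⊗₁ id) ⨾ 𝐁₂)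
    by-pentagon = uncur-natural ○ (refl⟩⨾⟨ uncur-natural) ○ (refl⟩⨾⟨ refl⟩⨾⟨ uncur-𝐁₂) ○ (refl⟩⨾⟨ 𝐁₃-β)
      ○ (refl⟩⨾⟨ refl⟩⨾⟨ ((refl ⟩⊗⟨ uncur-𝐁₂) ⟩⨾⟨ uncur-id)) ○ 𝐁₃-pentagon
      ○ sym (uncur-natural ○ (refl⟩⨾⟨ uncur-𝐁₂) ○ 𝐁₃-β ○ (refl⟩⨾⟨ ((refl ⟩⊗⟨ uncur-id) ⟩⨾⟨ uncur-𝐁₂)))
    uncurried : uncur ((act 𝐁 ⨾ act 𝐁) ⨾ act ((𝐂± s · 𝐁) · 𝐁)) ≈ uncur (act 𝐁 ⨾ act (𝐁 · 𝐁))
    uncurried = lhs₁ ○ uncur-injective (lhs₂ ○ uncur-injective by-pentagon ○ sym rhs₂) ○ sym rhs₁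

  ext₅ : ∀ s t → ((𝐁 · ((𝐂± s · 𝐁) · 𝐂± t)) · ((𝐁 · 𝐁) · 𝐁)) ≈ ((𝐁 · (𝐁 · 𝐂± t)) · ((𝐁 · 𝐁) · 𝐁))
  ext₅ s t = act-injective (act-𝐁·· ○ (act-𝐁·· ⟩⨾⟨refl) ○ uncur-injective uncurried
    ○ sym (act-𝐁·· ○ (act-𝐁·· ⟩⨾⟨refl)))
    where
    lhs₁ : uncur ((act 𝐁 ⨾ act 𝐁) ⨾ act ((𝐂± s · 𝐁) · 𝐂± t)) ≈ ((act 𝐁 ⊗₁ act (𝐂± t)) ⨾ 𝐁₂)
    lhs₁ = uncur-natural ○ (refl⟩⨾⟨ uncur-act-𝐂±𝐁· s) ○ pullˡ (sym serialize₁₂) ○ ⨾act𝐁⊗⨾app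
    rhs₁ : uncur ((act 𝐁 ⨾ act 𝐁) ⨾ act (𝐁 · 𝐂± t)) ≈ ((act 𝐁 ⊗₁ id) ⨾ 𝐁₂ ⨾ act (𝐂± t))
    rhs₁ = uncur-natural ○ (refl⟩⨾⟨ uncur-act-𝐁·) ○ (⊗id-homo ⟩⨾⟨refl) ○ assoc ○ (refl⟩⨾⟨ pullˡ uncur-act-𝐁)
    lhs₂ : uncur ((act 𝐁 ⊗₁ act (𝐂± t)) ⨾ 𝐁₂) ≈ (α⇒ ⨾ (id ⊗₁ 𝐂±₂ t) ⨾ 𝐁₂)
    lhs₂ = uncur-natural ○ (refl⟩⨾⟨ uncur-𝐁₂) ○ 𝐁₃-β ○ (refl⟩⨾⟨ ((refl ⟩⊗⟨ uncur-act-𝐂± t) ⟩⨾⟨ uncur-act-𝐁))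
    rhs₂ : uncur ((act 𝐁 ⊗₁ id) ⨾ 𝐁₂ ⨾ act (𝐂± t)) ≈ (((act 𝐁 ⊗₁ id) ⊗₁ id) ⨾ (𝐁₂ ⊗₁ id) ⨾ 𝐂±₂ t)
    rhs₂ = uncur-natural ○ (refl⟩⨾⟨ uncur-natural) ○ (refl⟩⨾⟨ refl⟩⨾⟨ uncur-act-𝐂± t)
    lhs₃ : uncur (α⇒ ⨾ (id ⊗₁ 𝐂±₂ t) ⨾ 𝐁₂)
           ≈ ((α⇒ ⊗₁ id) ⨾ α⇒ ⨾ (id ⊗₁ on₂₃ (braid t)) ⨾ (id ⊗₁ uncur app) ⨾ app)
    lhs₃ = uncur-natural ○ (refl⟩⨾⟨ uncur-natural) ○ (refl⟩⨾⟨ refl⟩⨾⟨ uncur-𝐁₂) ○ (refl⟩⨾⟨ 𝐁₃-β)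
      ○ (refl⟩⨾⟨ refl⟩⨾⟨ ((refl ⟩⊗⟨ (uncur-𝐂±₂ t ○ 𝐂±₃≈braid-form t ○ sym assoc₃)) ⟩⨾⟨ uncur-id))
      ○ (refl⟩⨾⟨ refl⟩⨾⟨ ((id⊗-homo ⟩⨾⟨refl) ○ assoc))
    rhs₃ : uncur (((act 𝐁 ⊗₁ id) ⊗₁ id) ⨾ (𝐁₂ ⊗₁ id) ⨾ 𝐂±₂ t)
           ≈ ((α⇒ ⊗₁ id) ⨾ α⇒ ⨾ (id ⊗₁ on₂₃ (braid t)) ⨾ (id ⊗₁ uncur app) ⨾ app)
    rhs₃ = uncur-natural ○ (refl⟩⨾⟨ uncur-natural) ○ (refl⟩⨾⟨ refl⟩⨾⟨ uncur-𝐂±₂ t) ○ (refl⟩⨾⟨ 𝐂±₃-β t)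
      ○ on₂₃-natural₁
      ○ (refl⟩⨾⟨ refl⟩⨾⟨ refl⟩⨾⟨ (pullˡ (⊗-merge ○ (((refl⟩⨾⟨ uncur-𝐁₂) ○ act𝐁⊗id⊗id⨾𝐁₃) ⟩⊗⟨ identityˡ))
        ○ uncur-α⇒⨾id⊗app⨾𝐁₂))
      ○ on₂₃-reassoc
    uncurried : uncur ((act 𝐁 ⨾ act 𝐁) ⨾ act ((𝐂± s · 𝐁) · 𝐂± t)) ≈ uncur ((act 𝐁 ⨾ act 𝐁) ⨾ act (𝐁 · 𝐂± t))
    uncurried = lhs₁ ○ uncur-injective (lhs₂ ○ uncur-injective (lhs₃ ○ sym rhs₃) ○ sym rhs₂) ○ sym rhs₁

  bal₁ : ∀ s t → ((𝐁 · (𝐁 · 𝛉± t)) · 𝐁) ≈ ((𝐁 · ((𝐂± s · 𝐁) · 𝛉± t)) · 𝐁)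
  bal₁ s t = act-injective (act-𝐁·· ○ uncur-injective uncurried ○ sym act-𝐁··)
    where
    lhs₁ : uncur (act 𝐁 ⨾ act (𝐁 · 𝛉± t)) ≈ (𝐁₂ ⨾ act (𝛉± t))
    lhs₁ = uncur-natural ○ (refl⟩⨾⟨ uncur-act-𝐁·) ○ pullˡ uncur-act-𝐁
    rhs₁ : uncur (act 𝐁 ⨾ act ((𝐂± s · 𝐁) · 𝛉± t)) ≈ ((id ⊗₁ act (𝛉± t)) ⨾ 𝐁₂)
    rhs₁ = uncur-natural ○ (refl⟩⨾⟨ uncur-act-𝐂±𝐁· s) ○ extendˡ ⊗-slide ○ (refl⟩⨾⟨ uncur-act-𝐁)
    lhs₂ : uncur (𝐁₂ ⨾ act (𝛉± t)) ≈ (α⇒ ⨾ (id ⊗₁ ((id ⊗₁ θ± t) ⨾ app)) ⨾ app)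
    lhs₂ = uncur-natural ○ (refl⟩⨾⟨ uncur-act-𝛉± t) ○ extendˡ ⊗-slide ○ (refl⟩⨾⟨ uncur-𝐁₂)
      ○ extendˡ α⇒-natural₃ ○ (refl⟩⨾⟨ pullˡ (sym id⊗-homo))
    rhs₂ : uncur ((id ⊗₁ act (𝛉± t)) ⨾ 𝐁₂) ≈ (α⇒ ⨾ (id ⊗₁ ((id ⊗₁ θ± t) ⨾ app)) ⨾ app)
    rhs₂ = uncur-natural ○ (refl⟩⨾⟨ uncur-𝐁₂) ○ 𝐁₃-β ○ (refl⟩⨾⟨ ((refl ⟩⊗⟨ uncur-act-𝛉± t) ⟩⨾⟨ uncur-id))
    uncurried : uncur (act 𝐁 ⨾ act (𝐁 · 𝛉± t)) ≈ uncur (act 𝐁 ⨾ act ((𝐂± s · 𝐁) · 𝛉± t))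
    uncurried = lhs₁ ○ uncur-injective (lhs₂ ○ sym rhs₂) ○ sym rhs₁

  ext₆ : ∀ s → ((𝐁 · (𝐁 · 𝐂± s)) · ((𝐁 · 𝐂± s) · (𝐁 · 𝐂± s))) ≈ ((𝐁 · 𝐂± s) · ((𝐁 · (𝐁 · 𝐂± s)) · 𝐂± s))
  ext₆ s = act-injective (act-𝐁·· ○ (act-𝐁·· ⟩⨾⟨refl) ○ uncur-injective uncurried
    ○ sym (act-𝐁·· ○ (act-𝐁·· ⟩⨾⟨refl)))
    where
    c d : A ⇒ A
    c = act (𝐂± s)
    d = act (𝐁 · 𝐂± s)
    lhs₁ : uncur ((d ⨾ c) ⨾ d) ≈ ((d ⊗₁ id) ⨾ 𝐂±₂ s ⨾ c)
    lhs₁ = uncur-natural ○ (refl⟩⨾⟨ uncur-act-𝐁·) ○ (⊗id-homo ⟩⨾⟨refl) ○ assoc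
      ○ (refl⟩⨾⟨ pullˡ (uncur-act-𝐂± s))
    rhs₁ : uncur ((c ⨾ d) ⨾ c) ≈ (((c ⨾ d) ⊗₁ id) ⨾ 𝐂±₂ s)
    rhs₁ = uncur-natural ○ (refl⟩⨾⟨ uncur-act-𝐂± s)
    lhs₂ : uncur ((d ⊗₁ id) ⨾ 𝐂±₂ s ⨾ c) ≈ (((d ⊗₁ id) ⊗₁ id) ⨾ (𝐂±₂ s ⊗₁ id) ⨾ 𝐂±₂ s)
    lhs₂ = uncur-natural ○ (refl⟩⨾⟨ uncur-natural) ○ (refl⟩⨾⟨ refl⟩⨾⟨ uncur-act-𝐂± s)
    rhs₂ : uncur (((c ⨾ d) ⊗₁ id) ⨾ 𝐂±₂ s) ≈ (α⇒ ⨾ (id ⊗₁ braid s) ⨾ α⇐ ⨾ (𝐂±₂ s ⊗₁ id) ⨾ 𝐂±₂ s)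
    rhs₂ = uncur-natural ○ (refl⟩⨾⟨ uncur-𝐂±₂ s) ○ 𝐂±₃-β s ○ (refl⟩⨾⟨ refl⟩⨾⟨ refl⟩⨾⟨ uncur²-c⨾d)
      where
      uncur²-c⨾d : ((uncur (c ⨾ d) ⊗₁ id) ⨾ app) ≈ ((𝐂±₂ s ⊗₁ id) ⨾ 𝐂±₂ s)
      uncur²-c⨾d = uncur-resp-≈ (uncur-natural ○ (refl⟩⨾⟨ uncur-act-𝐁·) ○ pullˡ (uncur-act-𝐂± s))
        ○ uncur-natural ○ (refl⟩⨾⟨ uncur-act-𝐂± s)
    lhs₃ : uncur (((d ⊗₁ id) ⊗₁ id) ⨾ (𝐂±₂ s ⊗₁ id) ⨾ 𝐂±₂ s)
           ≈ (α⇒ ⨾ (id ⊗₁ braid s) ⨾ α⇐ ⨾ (α⇒ ⊗₁ id) ⨾ ((id ⊗₁ braid s) ⊗₁ id) ⨾ (α⇐ ⊗₁ id)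
              ⨾ α⇒ ⨾ (id ⊗₁ braid s) ⨾ α⇐ ⨾ (uncur app ⊗₁ id) ⨾ app)
    lhs₃ = uncur-natural ○ (refl⟩⨾⟨ uncur-natural) ○ (refl⟩⨾⟨ refl⟩⨾⟨ uncur-𝐂±₂ s) ○ (refl⟩⨾⟨ 𝐂±₃-β s)
      ○ on₂₃-natural₁
      ○ (refl⟩⨾⟨ refl⟩⨾⟨ refl⟩⨾⟨
          (pullˡ (⊗-merge ○ (d⊗id⊗id⨾𝐂±₃ ⟩⊗⟨ identityˡ)) ○ uncur-on₂₃⨾app⊗id⨾𝐂±₂))
      where
      d⊗id⊗id⨾𝐂±₃ : (((d ⊗₁ id) ⊗₁ id) ⨾ uncur (𝐂±₂ s)) ≈ (α⇒ ⨾ (id ⊗₁ braid s) ⨾ α⇐ ⨾ (app ⊗₁ id) ⨾ 𝐂±₂ s)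
      d⊗id⊗id⨾𝐂±₃ = (refl⟩⨾⟨ uncur-𝐂±₂ s) ○ 𝐂±₃-β s
        ○ (refl⟩⨾⟨ refl⟩⨾⟨ refl⟩⨾⟨ (((uncur-act-𝐁· ⟩⊗⟨ refl) ⟩⨾⟨refl) ○ (⊗id-homo ⟩⨾⟨refl) ○ assoc
          ○ (refl⟩⨾⟨ uncur-act-𝐂± s)))
      uncur-on₂₃⨾app⊗id⨾𝐂±₂ : uncur (α⇒ ⨾ (id ⊗₁ braid s) ⨾ α⇐ ⨾ (app ⊗₁ id) ⨾ 𝐂±₂ s)
        ≈ ((α⇒ ⊗₁ id) ⨾ ((id ⊗₁ braid s) ⊗₁ id) ⨾ (α⇐ ⊗₁ id)
           ⨾ α⇒ ⨾ (id ⊗₁ braid s) ⨾ α⇐ ⨾ (uncur app ⊗₁ id) ⨾ app)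
      uncur-on₂₃⨾app⊗id⨾𝐂±₂ = uncur-natural ○ (refl⟩⨾⟨ uncur-natural) ○ (refl⟩⨾⟨ refl⟩⨾⟨ uncur-natural)
        ○ (refl⟩⨾⟨ refl⟩⨾⟨ refl⟩⨾⟨ uncur-natural)
        ○ (refl⟩⨾⟨ refl⟩⨾⟨ refl⟩⨾⟨ refl⟩⨾⟨ uncur-𝐂±₂ s) ○ (refl⟩⨾⟨ refl⟩⨾⟨ refl⟩⨾⟨ 𝐂±₃-β s)
    rhs₃ : uncur (α⇒ ⨾ (id ⊗₁ braid s) ⨾ α⇐ ⨾ (𝐂±₂ s ⊗₁ id) ⨾ 𝐂±₂ s)
           ≈ ((α⇒ ⊗₁ id) ⨾ ((id ⊗₁ braid s) ⊗₁ id) ⨾ (α⇐ ⊗₁ id) ⨾ α⇒ ⨾ (id ⊗₁ braid s) ⨾ α⇐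
              ⨾ (α⇒ ⊗₁ id) ⨾ ((id ⊗₁ braid s) ⊗₁ id) ⨾ (α⇐ ⊗₁ id) ⨾ (uncur app ⊗₁ id) ⨾ app)
    rhs₃ = uncur-natural ○ (refl⟩⨾⟨ uncur-natural) ○ (refl⟩⨾⟨ refl⟩⨾⟨ uncur-natural)
      ○ (refl⟩⨾⟨ refl⟩⨾⟨ refl⟩⨾⟨ uncur-natural)
      ○ (refl⟩⨾⟨ refl⟩⨾⟨ refl⟩⨾⟨ refl⟩⨾⟨ uncur-𝐂±₂ s) ○ (refl⟩⨾⟨ refl⟩⨾⟨ refl⟩⨾⟨ 𝐂±₃-β s)
      ○ (refl⟩⨾⟨ refl⟩⨾⟨ refl⟩⨾⟨ refl⟩⨾⟨ refl⟩⨾⟨ refl⟩⨾⟨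
          (uncur-resp-≈ (uncur-𝐂±₂ s ○ 𝐂±₃≈braid-form s) ○ uncur-natural ○ (refl⟩⨾⟨ uncur-natural)
            ○ (refl⟩⨾⟨ refl⟩⨾⟨ uncur-natural)))
    uncurried : uncur ((d ⨾ c) ⨾ d) ≈ uncur ((c ⨾ d) ⨾ c)
    uncurried = lhs₁
      ○ uncur-injective (lhs₂ ○ uncur-injective (lhs₃ ○ yang-baxter₂₃₄ s ○ sym rhs₃) ○ sym rhs₂)
      ○ sym rhs₁

  ext₇ : ∀ s → ((𝐁 · (𝐁 · 𝐁)) · 𝐂± s) ≈ ((𝐁 · 𝐂± s) · ((𝐁 · (𝐁 · 𝐂± s)) · 𝐁))
  ext₇ s = act-injective (act-𝐁·· ○ uncur-injective uncurried ○ sym (act-𝐁·· ○ (act-𝐁·· ⟩⨾⟨refl)))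
    where
    c d : A ⇒ A
    c = act (𝐂± s)
    d = act (𝐁 · 𝐂± s)
    lhs₁ : uncur (c ⨾ act (𝐁 · 𝐁)) ≈ (𝐂±₂ s ⨾ act 𝐁)
    lhs₁ = uncur-natural ○ (refl⟩⨾⟨ uncur-act-𝐁·) ○ pullˡ (uncur-act-𝐂± s)
    rhs₁ : uncur ((act 𝐁 ⨾ d) ⨾ c) ≈ (((act 𝐁 ⨾ d) ⊗₁ id) ⨾ 𝐂±₂ s)
    rhs₁ = uncur-natural ○ (refl⟩⨾⟨ uncur-act-𝐂± s)
    lhs₂ : uncur (𝐂±₂ s ⨾ act 𝐁) ≈ ((𝐂±₂ s ⊗₁ id) ⨾ 𝐁₂)
    lhs₂ = uncur-natural ○ (refl⟩⨾⟨ uncur-act-𝐁)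
    rhs₂ : uncur (((act 𝐁 ⨾ d) ⊗₁ id) ⨾ 𝐂±₂ s) ≈ (α⇒ ⨾ (id ⊗₁ braid s) ⨾ α⇐ ⨾ (𝐁₂ ⊗₁ id) ⨾ 𝐂±₂ s)
    rhs₂ = uncur-natural ○ (refl⟩⨾⟨ uncur-𝐂±₂ s) ○ 𝐂±₃-β s ○ (refl⟩⨾⟨ refl⟩⨾⟨ refl⟩⨾⟨ uncur²-act𝐁⨾d)
      where
      uncur²-act𝐁⨾d : ((uncur (act 𝐁 ⨾ d) ⊗₁ id) ⨾ app) ≈ ((𝐁₂ ⊗₁ id) ⨾ 𝐂±₂ s)
      uncur²-act𝐁⨾d = uncur-resp-≈ (uncur-natural ○ (refl⟩⨾⟨ uncur-act-𝐁·) ○ pullˡ uncur-act-𝐁)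
        ○ uncur-natural ○ (refl⟩⨾⟨ uncur-act-𝐂± s)
    lhs₃ : uncur ((𝐂±₂ s ⊗₁ id) ⨾ 𝐁₂)
           ≈ ((α⇒ ⊗₁ id) ⨾ α⇒ ⨾ (id ⊗₁ ((braid s ⊗₁ id) ⨾ on₂₃ (braid s)))
              ⨾ α⇐ ⨾ ((id ⊗₁ app) ⊗₁ id) ⨾ uncur app)
    lhs₃ = uncur-natural ○ (refl⟩⨾⟨ uncur-𝐁₂) ○ 𝐁₃-β
      ○ (refl⟩⨾⟨ ((refl ⟩⊗⟨ uncur-id) ⟩⨾⟨ (uncur-𝐂±₂ s ○ 𝐂±₃≈braid-form s)))
      ○ (refl⟩⨾⟨ extendˡ α⇒-natural₃)
      ○ (refl⟩⨾⟨ refl⟩⨾⟨ extendˡ (sym id⊗-homo ○ (refl ⟩⊗⟨ braid-natural s) ○ id⊗-homo))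
      ○ (refl⟩⨾⟨ refl⟩⨾⟨ refl⟩⨾⟨ extendˡ α⇐-natural)
      ○ sym pentagonˡ
      ○ (refl⟩⨾⟨ refl⟩⨾⟨ pullˡ (sym id⊗-homo))
      ○ (refl⟩⨾⟨ refl⟩⨾⟨ ((refl ⟩⊗⟨ sym (braid-hexagon-α⇐ s)) ⟩⨾⟨refl))
    rhs₃ : uncur (α⇒ ⨾ (id ⊗₁ braid s) ⨾ α⇐ ⨾ (𝐁₂ ⊗₁ id) ⨾ 𝐂±₂ s)
           ≈ ((α⇒ ⊗₁ id) ⨾ α⇒ ⨾ (id ⊗₁ ((braid s ⊗₁ id) ⨾ on₂₃ (braid s)))
              ⨾ α⇐ ⨾ ((id ⊗₁ app) ⊗₁ id) ⨾ uncur app)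
    rhs₃ = uncur-natural ○ (refl⟩⨾⟨ uncur-natural) ○ (refl⟩⨾⟨ refl⟩⨾⟨ uncur-natural)
      ○ (refl⟩⨾⟨ refl⟩⨾⟨ refl⟩⨾⟨ uncur-natural)
      ○ (refl⟩⨾⟨ refl⟩⨾⟨ refl⟩⨾⟨ refl⟩⨾⟨ uncur-𝐂±₂ s) ○ (refl⟩⨾⟨ refl⟩⨾⟨ refl⟩⨾⟨ 𝐂±₃-β s)
      ○ (refl⟩⨾⟨ refl⟩⨾⟨ refl⟩⨾⟨ refl⟩⨾⟨ refl⟩⨾⟨ refl⟩⨾⟨ (uncur-resp-≈ uncur-𝐁₂ ○ uncur-𝐁₃))
      ○ (refl⟩⨾⟨ refl⟩⨾⟨ refl⟩⨾⟨ refl⟩⨾⟨ refl⟩⨾⟨ refl⟩⨾⟨ refl⟩⨾⟨ sym (cancelˡ (α-isoˡ {A} {A ⊗₀ A} {A})))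
      ○ (refl⟩⨾⟨ refl⟩⨾⟨ refl⟩⨾⟨ on₂₃-reassoc)
      ○ on₂₃⊗id-reassoc
      ○ (refl⟩⨾⟨ refl⟩⨾⟨ pullˡ (sym id⊗-homo))
    uncurried : uncur (c ⨾ act (𝐁 · 𝐁)) ≈ uncur ((act 𝐁 ⨾ d) ⨾ c)
    uncurried = lhs₁ ○ uncur-injective (lhs₂ ○ uncur-injective (lhs₃ ○ sym rhs₃) ○ sym rhs₂) ○ sym rhs₁

  bal₄ : ∀ s → ((𝐁 · 𝐁) · 𝛉± s) ≈ ((𝐁 · 𝛉± s) · ((𝐁 · 𝐂± s) · ((𝐁 · 𝛉± s) · ((𝐁 · 𝐂± s) · 𝐁))))
  bal₄ s = act-injective (act-𝐁·· ○ uncur-injective uncurried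
    ○ sym (act-𝐁·· ○ (act-𝐁·· ⟩⨾⟨refl) ○ ((act-𝐁·· ⟩⨾⟨refl) ⟩⨾⟨refl) ○ (((act-𝐁·· ⟩⨾⟨refl) ⟩⨾⟨refl) ⟩⨾⟨refl)))
    where
    c t : A ⇒ A
    c = act (𝐂± s)
    t = act (𝛉± s)
    uncur-⨾c⨾t : ∀ {f : A ⇒ A} → uncur ((f ⨾ c) ⨾ t) ≈ ((f ⊗₁ θ± s) ⨾ 𝐂±₂ s)
    uncur-⨾c⨾t = uncur-natural ○ (refl⟩⨾⟨ uncur-act-𝛉± s) ○ (⊗id-homo ⟩⨾⟨refl) ○ assoc
      ○ (refl⟩⨾⟨ extendˡ ⊗-slide)
      ○ (refl⟩⨾⟨ refl⟩⨾⟨ uncur-act-𝐂± s) ○ pullˡ (sym serialize₁₂)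
    lhs₁ : uncur (t ⨾ act 𝐁) ≈ ((t ⊗₁ id) ⨾ 𝐁₂)
    lhs₁ = uncur-natural ○ (refl⟩⨾⟨ uncur-act-𝐁)
    lhs₂ : uncur ((t ⊗₁ id) ⨾ 𝐁₂) ≈ (α⇒ ⨾ (id ⊗₁ app) ⨾ (id ⊗₁ θ± s) ⨾ app)
    lhs₂ = uncur-natural ○ (refl⟩⨾⟨ uncur-𝐁₂) ○ 𝐁₃-β ○ (refl⟩⨾⟨ ((refl ⟩⊗⟨ uncur-id) ⟩⨾⟨ uncur-act-𝛉± s))
    uncur²-act𝐁⨾c⨾t : ((uncur ((act 𝐁 ⨾ c) ⨾ t) ⊗₁ θ± s) ⨾ app)
                      ≈ (α⇒ ⨾ (act 𝐁 ⊗₁ (θ± s ⊗₁ θ± s)) ⨾ (id ⊗₁ braid s) ⨾ α⇐ ⨾ uncur app)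
    uncur²-act𝐁⨾c⨾t = ((uncur-⨾c⨾t ⟩⊗⟨ sym identityʳ) ⟩⨾⟨refl) ○ (sym ⊗-merge ⟩⨾⟨refl) ○ assoc
      ○ (refl⟩⨾⟨ (uncur-𝐂±₂ s ○ 𝐂±₃≈braid-form s)) ○ extendˡ α-natural
    by-balance : ∀ {Z} {r : A ⊗₀ (A ⊗₀ A) ⇒ Z} →
                 ((id ⊗₁ braid s) ⨾ (act 𝐁 ⊗₁ (θ± s ⊗₁ θ± s)) ⨾ (id ⊗₁ braid s) ⨾ r)
                   ≈ ((id ⊗₁ θ± s) ⨾ (act 𝐁 ⊗₁ id) ⨾ r)
    by-balance = pullˡ ⊗-merge ○ pullˡ ⊗-merge
      ○ (((identityʳ ○ identityˡ) ⟩⊗⟨ (assoc ○ sym (θ±-balance s))) ⟩⨾⟨refl) ○ (serialize₂₁ ⟩⨾⟨refl) ○ assoc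
    rhs₂ : uncur ((((act 𝐁 ⨾ c) ⨾ t) ⊗₁ θ± s) ⨾ 𝐂±₂ s) ≈ (α⇒ ⨾ (id ⊗₁ app) ⨾ (id ⊗₁ θ± s) ⨾ app)
    rhs₂ = uncur-natural ○ (refl⟩⨾⟨ uncur-𝐂±₂ s) ○ 𝐂±₃-β s ○ (refl⟩⨾⟨ refl⟩⨾⟨ refl⟩⨾⟨ uncur²-act𝐁⨾c⨾t)
      ○ (refl⟩⨾⟨ refl⟩⨾⟨ cancelˡ α-isoʳ) ○ (refl⟩⨾⟨ by-balance)
      ○ (refl⟩⨾⟨ refl⟩⨾⟨ extendˡ α⇐-natural₁)
      ○ (refl⟩⨾⟨ refl⟩⨾⟨ refl⟩⨾⟨ pullˡ (⊗-merge ○ (uncur-act-𝐁 ⟩⊗⟨ identityˡ)))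
      ○ (refl⟩⨾⟨ refl⟩⨾⟨ refl⟩⨾⟨ uncur-𝐁₂)
      ○ (refl⟩⨾⟨ refl⟩⨾⟨ cancelˡ α-isoʳ)
      ○ (refl⟩⨾⟨ pullˡ (sym id⊗-homo))
      ○ (refl⟩⨾⟨ ((refl ⟩⊗⟨ sym (θ±-natural s)) ⟩⨾⟨refl))
      ○ (refl⟩⨾⟨ ((id⊗-homo ⟩⨾⟨refl) ○ assoc))
    uncurried : uncur (t ⨾ act 𝐁) ≈ uncur ((((act 𝐁 ⨾ c) ⨾ t) ⨾ c) ⨾ t)
    uncurried = lhs₁ ○ uncur-injective (lhs₂ ○ sym rhs₂) ○ sym uncur-⨾c⨾t

proposition3p16 : ∀ {o ℓ e} (𝐂 : BalancedMonoidalCategory o ℓ e) (R : ReflexiveObject 𝐂) →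
  IsBalancedExtBCIAlgebra (Combinators.elemSetoid 𝐂 R) (Combinators._·_ 𝐂 R)
    (Combinators.𝐁 𝐂 R) (Combinators.𝐈 𝐂 R) (Combinators.𝐂± 𝐂 R) (Combinators.𝛉± 𝐂 R)
proposition3p16 𝐂 R = record { Axioms 𝐂 R }
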